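{- Let $p$ be a prime. For every constant $\varepsilon>0$ there is a constant $\beta>0$ (depending only on $p$ and $\varepsilon$) such that for every positive integer $n$, $$\mathcal{R}^{\mathrm{bool},p}_{M_n}(\beta\log n)\;\ge\;4^n\left(\frac12-\frac{1}{n^{1/2-\varepsilon}}\right).$$
   Context: $\mathbb{F}_p$ is the field with $p$ elements; $\log$ is base 2. For $x\in\mathbb{F}_p$ define $\mathrm{bool}(x)=1$ if $x=1$ in $\mathbb{F}_p$ and $\mathrm{bool}(x)=-1$ otherwise. For $A\in\{ -1,1\}^{N\times N}$ and real $r\ge0$, the Boolean rigidity $\mathcal{R}^{\mathrm{bool},p}_{A}(r)$ is the minimum, over all $L\in\mathbb{F}_p^{N\times N}$ with $\mathbb{F}_p$-rank at most $r$, of the number of pairs $(i,j)$ with $A[i,j]\neq\mathrm{bool}(L[i,j])$. The distance matrix $M_n$ is the $2^n\times 2^n$ matrix with rows and columns indexed by $\{0,1\}^n$ and $M_n[x,y]=1$ if the Hamming distance between $x$ and $y$ is at most $n/2$, and $M_n[x,y]=-1$ otherwise. -}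

module Defs where

open import Data.Bool using (Bool; true; false; if_then_else_; _xor_)
open import Data.Nat using (ℕ; zero; suc; _+_; _*_; _≤ᵇ_; NonZero)
open import Data.Nat.DivMod using (_mod_)
open import Data.Fin using (Fin; toℕ)
open import Data.Vec using (Vec; []; _∷_)
open import Data.List using (List; []; _∷_; map; concatMap; allFin)
open import Data.Nat.ListAction using (sum)
open import Data.Product using (Σ; ∃; _×_)
open import Relation.Binary.PropositionalEquality using (_≡_)
open import Relation.Nullary.Decidable using (⌊_⌋)
open import Data.Nat using (_≟_)

cube : (n : ℕ) → List (Vec Bool n)
cube zero    = [] ∷ []
cube (suc n) = concatMap (λ v → (false ∷ v) ∷ (true ∷ v) ∷ []) (cube n)

hamming : {n : ℕ} → Vec Bool n → Vec Bool n → ℕ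
hamming []       []       = 0
hamming (a ∷ x) (b ∷ y) = (if a xor b then 1 else 0) + hamming x y

-- {-1,1}-valued matrices are encoded as Bool-valued: true = 1, false = -1.
-- The distance matrix M_n: entry 1 iff hamming(x,y) ≤ n/2, i.e. 2·hamming ≤ n.
M : (n : ℕ) → Vec Bool n → Vec Bool n → Bool
M n x y = (2 * hamming x y) ≤ᵇ n

-- bool : F_p → {-1,1}; true (= 1) iff x = 1 in F_p. F_p is Fin p.
boolF : {p : ℕ} → Fin p → Bool
boolF x = ⌊ toℕ x ≟ 1 ⌋

RankAtMost : (p : ℕ) .{{_ : NonZero p}} {I : Set} → (I → I → Fin p) → ℕ → Set
RankAtMost p {I} L r =
  Σ (I → Fin r → Fin p) λ U → Σ (Fin r → I → Fin p) λ V →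
    ∀ x y → L x y ≡ (sum (map (λ k → toℕ (U x k) * toℕ (V k y)) (allFin r))) mod p

mismatches : {p : ℕ} (n : ℕ) → (Vec Bool n → Vec Bool n → Bool)
           → (Vec Bool n → Vec Bool n → Fin p) → ℕ
mismatches n A L =
  sum (map (λ x → sum (map (λ y → if A x y xor boolF (L x y) then 1 else 0) (cube n))) (cube n))

-- "R^{bool,p}_A(s) ≥ T", unfolding the minimum: every L of F_p-rank ≤ s
-- (i.e. rank ≤ r for every integer r ≤ s) has at least T mismatches.
-- Here s = β log₂ n with β = a/b, and the integer rank r satisfies
-- r ≤ (a/b) log₂ n  ⟺  2^(b r) ≤ n^a.

{-# OPTIONS --safe #-}
-- The correlation Σ M_n[x,y] · bool(L[x,y]) equals
-- 4^n − 2 · #mismatches, so it suffices to show  correlation² · n ≤ p^r · 16^n.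
-- M_n is the XOR-convolution matrix M_n[x,y] = f(x ⊕ y) of the threshold function
-- f(z) = [|z| ≤ n/2].  Its unnormalised Fourier coefficients satisfy f̂(α)² · n ≤ 4^n, since they
-- are bounded by middle binomial coefficients and C(m,⌈m/2⌉)² (m+1) ≤ 4^m; with the convolution
-- identity, Parseval and Cauchy–Schwarz this gives (uᵀ M_n t)² · n ≤ 4^n ‖u‖² ‖t‖².
-- A rank-r factorisation over F_p makes column y of L a function of a vector in F_p^r, so the
-- sign matrix of L is Σ_k u_k t_kᵀ with ±1 vectors u_k and indicators t_k of at most p^r column
-- classes; Cauchy–Schwarz over the classes gives the bound.  Finally β = 2ε/p with ε = c/d
-- makes p^r ≤ 2^(pr) ≤ n^(2ε).
module Submission where

open import Defs
open import Data.Bool using (Bool; true; false; if_then_else_; _xor_; _∧_)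
open import Data.Fin using (Fin; toℕ)
open import Data.List using (List; []; _∷_; _++_; map; concatMap; length; allFin)
open import Data.Product using (Σ; _×_; _,_)
open import Data.Vec using (Vec; []; _∷_)
open import Relation.Binary.PropositionalEquality
open import Relation.Nullary using (Dec; does)

module Sums where
  open import Data.Nat as ℕ using (ℕ)
  open import Data.Integer using (ℤ; +_; -[1+_]; 0ℤ; 1ℤ; _+_; _-_; _*_; _≤_; ∣_∣; +≤+; nonNegative)
  open import Data.Integer.Properties
  open import Data.Nat.ListAction using (sum)
  open import Data.Integer.Tactic.RingSolver using (solve-∀)
  open ≡-Reasoning

  private
    variable
      A B : Set

  ∑ : List A → (A → ℤ) → ℤ
  ∑ []       f = 0ℤ
  ∑ (x ∷ xs) f = f x + ∑ xs f

  infixl 10 ∑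
  syntax ∑ xs (λ x → e) = ∑[ x ∈ xs ] e

  ∑-cong : (xs : List A) {f g : A → ℤ} → (∀ a → f a ≡ g a) → ∑ xs f ≡ ∑ xs g
  ∑-cong []       f≗g = refl
  ∑-cong (x ∷ xs) f≗g = cong₂ _+_ (f≗g x) (∑-cong xs f≗g)

  ∑-zero : (xs : List A) → ∑[ _ ∈ xs ] 0ℤ ≡ 0ℤ
  ∑-zero []       = refl
  ∑-zero (x ∷ xs) = trans (+-identityˡ _) (∑-zero xs)

  ∑-distrib-+ : (xs : List A) (f g : A → ℤ) →
                ∑[ a ∈ xs ] (f a + g a) ≡ ∑ xs f + ∑ xs g
  ∑-distrib-+ []       f g = refl
  ∑-distrib-+ (x ∷ xs) f g = begin
    f x + g x + ∑[ a ∈ xs ] (f a + g a) ≡⟨ cong (_+_ (f x + g x)) (∑-distrib-+ xs f g) ⟩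
    f x + g x + (∑ xs f + ∑ xs g)       ≡⟨ swap (f x) (g x) (∑ xs f) (∑ xs g) ⟩
    f x + ∑ xs f + (g x + ∑ xs g)       ∎
    where
    swap : ∀ a b c d → a + b + (c + d) ≡ a + c + (b + d)
    swap = solve-∀

  ∑∑-distrib-+ : (xs : List A) (ys : List B) (h k : A → B → ℤ) →
    ∑[ a ∈ xs ] ∑[ b ∈ ys ] (h a b + k a b)
      ≡ ∑[ a ∈ xs ] ∑[ b ∈ ys ] h a b + ∑[ a ∈ xs ] ∑[ b ∈ ys ] k a b
  ∑∑-distrib-+ xs ys h k = trans (∑-cong xs (λ a → ∑-distrib-+ ys (h a) (k a))) (∑-distrib-+ xs _ _)

  *-distribˡ-∑ : (c : ℤ) (xs : List A) (f : A → ℤ) → c * ∑ xs f ≡ ∑[ a ∈ xs ] (c * f a)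
  *-distribˡ-∑ c []       f = *-zeroʳ c
  *-distribˡ-∑ c (x ∷ xs) f =
    trans (*-distribˡ-+ c (f x) (∑ xs f)) (cong (_+_ (c * f x)) (*-distribˡ-∑ c xs f))

  *-distribʳ-∑ : (c : ℤ) (xs : List A) (f : A → ℤ) → ∑ xs f * c ≡ ∑[ a ∈ xs ] (f a * c)
  *-distribʳ-∑ c xs f = begin
    ∑ xs f * c             ≡⟨ *-comm (∑ xs f) c ⟩
    c * ∑ xs f             ≡⟨ *-distribˡ-∑ c xs f ⟩
    ∑[ a ∈ xs ] (c * f a)  ≡⟨ ∑-cong xs (λ a → *-comm c (f a)) ⟩
    ∑[ a ∈ xs ] (f a * c)  ∎

  ∑-comm : (xs : List A) (ys : List B) (h : A → B → ℤ) →
           ∑[ a ∈ xs ] ∑[ b ∈ ys ] h a b ≡ ∑[ b ∈ ys ] ∑[ a ∈ xs ] h a b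
  ∑-comm []       ys h = sym (∑-zero ys)
  ∑-comm (x ∷ xs) ys h = begin
    ∑ ys (h x) + ∑[ a ∈ xs ] ∑[ b ∈ ys ] h a b ≡⟨ cong (_+_ (∑ ys (h x))) (∑-comm xs ys h) ⟩
    ∑ ys (h x) + ∑[ b ∈ ys ] ∑[ a ∈ xs ] h a b ≡⟨ ∑-distrib-+ ys (h x) (λ b → ∑[ a ∈ xs ] h a b) ⟨
    ∑[ b ∈ ys ] (h x b + ∑[ a ∈ xs ] h a b)    ∎

  ∑-*-∑ : (xs : List A) (ys : List B) (f : A → ℤ) (g : B → ℤ) →
          ∑ xs f * ∑ ys g ≡ ∑[ a ∈ xs ] ∑[ b ∈ ys ] (f a * g b)
  ∑-*-∑ xs ys f g = begin
    ∑ xs f * ∑ ys g                     ≡⟨ *-distribʳ-∑ (∑ ys g) xs f ⟩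
    ∑[ a ∈ xs ] (f a * ∑ ys g)          ≡⟨ ∑-cong xs (λ a → *-distribˡ-∑ (f a) ys g) ⟩
    ∑[ a ∈ xs ] ∑[ b ∈ ys ] (f a * g b) ∎

  *-distribˡ-∑∑ : (c : ℤ) (xs : List A) (ys : List B) (h : A → B → ℤ) →
                  c * ∑[ a ∈ xs ] ∑[ b ∈ ys ] h a b ≡ ∑[ a ∈ xs ] ∑[ b ∈ ys ] (c * h a b)
  *-distribˡ-∑∑ c xs ys h =
    trans (*-distribˡ-∑ c xs _) (∑-cong xs (λ a → *-distribˡ-∑ c ys (h a)))

  ∑-++ : (xs ys : List A) (f : A → ℤ) → ∑ (xs ++ ys) f ≡ ∑ xs f + ∑ ys f
  ∑-++ []       ys f = sym (+-identityˡ (∑ ys f))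
  ∑-++ (x ∷ xs) ys f =
    trans (cong (_+_ (f x)) (∑-++ xs ys f)) (sym (+-assoc (f x) (∑ xs f) (∑ ys f)))

  ∑-concatMap : (g : A → List B) (xs : List A) (f : B → ℤ) →
                ∑ (concatMap g xs) f ≡ ∑[ a ∈ xs ] ∑ (g a) f
  ∑-concatMap g []       f = refl
  ∑-concatMap g (x ∷ xs) f =
    trans (∑-++ (g x) (concatMap g xs) f) (cong (_+_ (∑ (g x) f)) (∑-concatMap g xs f))

  ∑-map : (k : A → B) (xs : List A) (f : B → ℤ) → ∑ (map k xs) f ≡ ∑[ a ∈ xs ] f (k a)
  ∑-map k []       f = refl
  ∑-map k (x ∷ xs) f = cong (_+_ (f (k x))) (∑-map k xs f)

  ∑-1 : (xs : List A) → ∑[ _ ∈ xs ] 1ℤ ≡ + length xs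
  ∑-1 []       = refl
  ∑-1 (x ∷ xs) = trans (cong (_+_ 1ℤ) (∑-1 xs)) (sym (pos-+ 1 (length xs)))

  ∑-pos : (xs : List A) (g : A → ℕ) → ∑[ a ∈ xs ] (+ g a) ≡ + sum (map g xs)
  ∑-pos []       g = refl
  ∑-pos (x ∷ xs) g = trans (cong (_+_ (+ g x)) (∑-pos xs g)) (sym (pos-+ (g x) _))

  ∑-mono-≤ : (xs : List A) {f g : A → ℤ} → (∀ a → f a ≤ g a) → ∑ xs f ≤ ∑ xs g
  ∑-mono-≤ []       f≤g = ≤-refl
  ∑-mono-≤ (x ∷ xs) f≤g = +-mono-≤ (f≤g x) (∑-mono-≤ xs f≤g)

  ∑-nonneg : (xs : List A) {f : A → ℤ} → (∀ a → 0ℤ ≤ f a) → 0ℤ ≤ ∑ xs f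
  ∑-nonneg xs {f} 0≤f = subst (_≤ ∑ xs f) (∑-zero xs) (∑-mono-≤ xs 0≤f)

  x*x≡∣x∣*∣x∣ : ∀ x → x * x ≡ + (∣ x ∣ ℕ.* ∣ x ∣)
  x*x≡∣x∣*∣x∣ (+ n)    = sym (pos-* n n)
  x*x≡∣x∣*∣x∣ -[1+ n ] = refl

  0≤x*x : ∀ x → 0ℤ ≤ x * x
  0≤x*x x = subst (0ℤ ≤_) (sym (x*x≡∣x∣*∣x∣ x)) (+≤+ ℕ.z≤n)

  lagrange-identity : (xs : List A) (f g : A → ℤ) →
    ∑[ a ∈ xs ] ∑[ b ∈ xs ] ((f a * g b - f b * g a) * (f a * g b - f b * g a))
      + + 2 * (∑[ a ∈ xs ] (f a * g a) * ∑[ a ∈ xs ] (f a * g a))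
      ≡ + 2 * (∑[ a ∈ xs ] (f a * f a) * ∑[ a ∈ xs ] (g a * g a))
  lagrange-identity {A} xs f g = begin
    ∑∑ sq + + 2 * (S * S)
      ≡⟨ cong (λ s → ∑∑ sq + + 2 * s) (∑-*-∑ xs xs fg fg) ⟩
    ∑∑ sq + + 2 * ∑∑ (λ a b → fg a * fg b)
      ≡⟨ cong (_+_ (∑∑ sq)) (*-distribˡ-∑∑ (+ 2) xs xs (λ a b → fg a * fg b)) ⟩
    ∑∑ sq + ∑∑ (λ a b → + 2 * (fg a * fg b))
      ≡⟨ ∑∑-distrib-+ xs xs sq (λ a b → + 2 * (fg a * fg b)) ⟨
    ∑∑ (λ a b → sq a b + + 2 * (fg a * fg b))
      ≡⟨ ∑-cong xs (λ a → ∑-cong xs (λ b → expand (f a) (g a) (f b) (g b))) ⟩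
    ∑∑ (λ a b → ff a * gg b + gg a * ff b)
      ≡⟨ ∑∑-distrib-+ xs xs (λ a b → ff a * gg b) (λ a b → gg a * ff b) ⟩
    ∑∑ (λ a b → ff a * gg b) + ∑∑ (λ a b → gg a * ff b)
      ≡⟨ cong₂ _+_ (∑-*-∑ xs xs ff gg) (∑-*-∑ xs xs gg ff) ⟨
    F * G + G * F
      ≡⟨ double F G ⟩
    + 2 * (F * G) ∎
    where
    ff gg fg : A → ℤ
    ff a = f a * f a
    gg a = g a * g a
    fg a = f a * g a
    sq : A → A → ℤ
    sq a b = (f a * g b - f b * g a) * (f a * g b - f b * g a)
    F = ∑ xs ff
    G = ∑ xs gg
    S = ∑ xs fg
    ∑∑ : (A → A → ℤ) → ℤ
    ∑∑ h = ∑[ a ∈ xs ] ∑[ b ∈ xs ] h a b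
    expand : ∀ x y z w → (x * w - z * y) * (x * w - z * y) + + 2 * (x * y * (z * w))
                       ≡ x * x * (w * w) + y * y * (z * z)
    expand = solve-∀
    double : ∀ F G → F * G + G * F ≡ + 2 * (F * G)
    double = solve-∀

  cauchy-schwarz : (xs : List A) (f g : A → ℤ) →
    ∑[ a ∈ xs ] (f a * g a) * ∑[ a ∈ xs ] (f a * g a)
      ≤ ∑[ a ∈ xs ] (f a * f a) * ∑[ a ∈ xs ] (g a * g a)
  cauchy-schwarz xs f g = *-cancelˡ-≤-pos SS FG (+ 2)
    (subst (+ 2 * SS ≤_) (lagrange-identity xs f g) (i≤j+i (+ 2 * SS) ∑∑sq {{nonNegative 0≤∑∑sq}}))
    where
    SS = ∑[ a ∈ xs ] (f a * g a) * ∑[ a ∈ xs ] (f a * g a)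
    FG = ∑[ a ∈ xs ] (f a * f a) * ∑[ a ∈ xs ] (g a * g a)
    ∑∑sq = ∑[ a ∈ xs ] ∑[ b ∈ xs ] ((f a * g b - f b * g a) * (f a * g b - f b * g a))
    0≤∑∑sq : 0ℤ ≤ ∑∑sq
    0≤∑∑sq = ∑-nonneg xs (λ a → ∑-nonneg xs (λ b → 0≤x*x (f a * g b - f b * g a)))

module Enumeration where
  open Sums
  open import Data.Nat as ℕ using (ℕ; zero; suc)
  import Data.Nat.Properties as ℕ
  open import Data.Integer using (ℤ; 0ℤ; 1ℤ; _*_)
  open import Data.Integer.Properties
  open import Relation.Binary.Definitions using (DecidableEquality)
  open import Relation.Nullary using (_because_; _×-dec_)
  import Data.List.Properties as List
  open import Data.Vec.Properties using (≡-dec)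
  open ≡-Reasoning

  private
    variable
      A : Set

  𝟙 : {P : Set} → Dec P → ℤ
  𝟙 P? = if does P? then 1ℤ else 0ℤ

  𝟙-×-dec : {P Q : Set} (P? : Dec P) (Q? : Dec Q) → 𝟙 (P? ×-dec Q?) ≡ 𝟙 P? * 𝟙 Q?
  𝟙-×-dec (true  because _) (true  because _) = refl
  𝟙-×-dec (true  because _) (false because _) = refl
  𝟙-×-dec (false because _) (true  because _) = refl
  𝟙-×-dec (false because _) (false because _) = refl

  -- xs lists every element of A exactly once.
  Sifting : DecidableEquality A → List A → Set
  Sifting {A} _≟_ xs = ∀ (h : A → ℤ) b → ∑[ a ∈ xs ] (h a * 𝟙 (a ≟ b)) ≡ h b

  vectors : List A → (n : ℕ) → List (Vec A n)
  vectors xs zero    = [] ∷ []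
  vectors xs (suc n) = concatMap (λ v → map (_∷ v) xs) (vectors xs n)

  length-vectors : (xs : List A) (n : ℕ) → length (vectors xs n) ≡ length xs ℕ.^ n
  length-vectors xs zero    = refl
  length-vectors {A} xs (suc n) =
    trans (length-concatMap (vectors xs n))
          (trans (cong (ℕ._* length xs) (length-vectors xs n)) (ℕ.*-comm _ (length xs)))
    where
    length-concatMap : ∀ {m} (vs : List (Vec A m)) →
      length (concatMap (λ v → map (_∷ v) xs) vs) ≡ length vs ℕ.* length xs
    length-concatMap []       = refl
    length-concatMap (v ∷ vs) = trans (List.length-++ (map (_∷ v) xs))
      (cong₂ ℕ._+_ (List.length-map (_∷ v) xs) (length-concatMap vs))

  ∑-vectors-suc : (xs : List A) (n : ℕ) (f : Vec A (suc n) → ℤ) →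
    ∑ (vectors xs (suc n)) f ≡ ∑[ v ∈ vectors xs n ] ∑[ a ∈ xs ] f (a ∷ v)
  ∑-vectors-suc xs n f = trans (∑-concatMap _ (vectors xs n) f)
                               (∑-cong (vectors xs n) (λ v → ∑-map (_∷ v) xs f))

  sifting-vectors : {_≟_ : DecidableEquality A} {xs : List A} → Sifting _≟_ xs →
                    (n : ℕ) → Sifting (≡-dec _≟_) (vectors xs n)
  sifting-vectors sift zero    h [] = trans (+-identityʳ _) (*-identityʳ (h []))
  sifting-vectors {A} {_≟_} {xs} sift (suc n) h (b ∷ u) = begin
    ∑[ v ∈ vectors xs (suc n) ] (h v * 𝟙 (v ≟ᵛ (b ∷ u)))
      ≡⟨ ∑-vectors-suc xs n _ ⟩
    ∑[ w ∈ vectors xs n ] ∑[ a ∈ xs ] (h (a ∷ w) * 𝟙 ((a ≟ b) ×-dec (w ≟ᵛ u)))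
      ≡⟨ ∑-cong (vectors xs n) (λ w → ∑-cong xs (λ a →
           trans (cong (h (a ∷ w) *_) (𝟙-×-dec (a ≟ b) (w ≟ᵛ u)))
                 (sym (*-assoc (h (a ∷ w)) _ _)))) ⟩
    ∑[ w ∈ vectors xs n ] ∑[ a ∈ xs ] (h (a ∷ w) * 𝟙 (a ≟ b) * 𝟙 (w ≟ᵛ u))
      ≡⟨ ∑-cong (vectors xs n) (λ w → *-distribʳ-∑ (𝟙 (w ≟ᵛ u)) xs _) ⟨
    ∑[ w ∈ vectors xs n ] (∑[ a ∈ xs ] (h (a ∷ w) * 𝟙 (a ≟ b)) * 𝟙 (w ≟ᵛ u))
      ≡⟨ ∑-cong (vectors xs n) (λ w → cong (_* 𝟙 (w ≟ᵛ u)) (sift (λ a → h (a ∷ w)) b)) ⟩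
    ∑[ w ∈ vectors xs n ] (h (b ∷ w) * 𝟙 (w ≟ᵛ u))
      ≡⟨ sifting-vectors sift n (λ w → h (b ∷ w)) u ⟩
    h (b ∷ u) ∎
    where
    _≟ᵛ_ : ∀ {m} → DecidableEquality (Vec A m)
    _≟ᵛ_ = ≡-dec _≟_

module Binomial where
  open import Data.Nat
  open import Data.Nat.Properties
  open import Data.Nat.Combinatorics
    using (_C_; nC1≡n; nCk+nC[k+1]≡[n+1]C[k+1]; nCk≡nC[n∸k]; k>n⇒nCk≡0)
  open import Data.Nat.Tactic.RingSolver using (solve-∀)
  open ≤-Reasoning

  data EvenOrOdd : ℕ → Set where
    even : ∀ k → EvenOrOdd (k + k)
    odd  : ∀ k → EvenOrOdd (suc (k + k))

  even-or-odd : ∀ n → EvenOrOdd n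
  even-or-odd zero    = even 0
  even-or-odd (suc n) with even-or-odd n
  ... | even k = odd k
  ... | odd k  = subst EvenOrOdd (cong suc (+-suc k k)) (even (suc k))

  ⌈k+k/2⌉≡k : ∀ k → ⌈ k + k /2⌉ ≡ k
  ⌈k+k/2⌉≡k k = +-cancelˡ-≡ k _ _ (begin-equality
    k + ⌈ k + k /2⌉         ≡⟨ cong (_+ ⌈ k + k /2⌉) (n≡⌊n+n/2⌋ k) ⟩
    ⌊ k + k /2⌋ + ⌈ k + k /2⌉ ≡⟨ ⌊n/2⌋+⌈n/2⌉≡n (k + k) ⟩
    k + k                   ∎)

  [1+k]*nC[1+k]+k*nCk≡n*nCk : ∀ n k → suc k * (n C suc k) + k * (n C k) ≡ n * (n C k)
  [1+k]*nC[1+k]+k*nCk≡n*nCk zero    zero    = refl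
  [1+k]*nC[1+k]+k*nCk≡n*nCk zero    (suc k)
    rewrite k>n⇒nCk≡0 {0} {suc k} (s≤s z≤n) = cong₂ _+_ (*-zeroʳ (2 + k)) (*-zeroʳ (suc k))
  [1+k]*nC[1+k]+k*nCk≡n*nCk (suc n) zero
    rewrite nC1≡n (suc n) = trans (+-identityʳ (1 * suc n)) (*-comm 1 (suc n))
  [1+k]*nC[1+k]+k*nCk≡n*nCk (suc n) (suc k) = begin-equality
    suc (suc k) * (suc n C suc (suc k)) + suc k * (suc n C suc k)
      ≡⟨ cong₂ (λ c d → suc (suc k) * c + suc k * d)
               (nCk+nC[k+1]≡[n+1]C[k+1] n (suc k)) (nCk+nC[k+1]≡[n+1]C[k+1] n k) ⟨
    suc (suc k) * (n C suc k + n C suc (suc k)) + suc k * (n C k + n C suc k)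
      ≡⟨ regroup k (n C k) (n C suc k) (n C suc (suc k)) ⟩
    (suc (suc k) * (n C suc (suc k)) + suc k * (n C suc k)) + (suc k * (n C suc k) + k * (n C k))
      + (n C k + n C suc k)
      ≡⟨ cong₂ (λ c d → c + d + (n C k + n C suc k))
               ([1+k]*nC[1+k]+k*nCk≡n*nCk n (suc k)) ([1+k]*nC[1+k]+k*nCk≡n*nCk n k) ⟩
    n * (n C suc k) + n * (n C k) + (n C k + n C suc k)
      ≡⟨ factor n (n C k) (n C suc k) ⟩
    suc n * (n C k + n C suc k)
      ≡⟨ cong (suc n *_) (nCk+nC[k+1]≡[n+1]C[k+1] n k) ⟩
    suc n * (suc n C suc k) ∎
    where
    regroup : ∀ k a b c → (2 + k) * (b + c) + (1 + k) * (a + b)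
                        ≡ ((2 + k) * c + (1 + k) * b) + ((1 + k) * b + k * a) + (a + b)
    regroup = solve-∀
    factor : ∀ n a b → n * b + n * a + (a + b) ≡ suc n * (a + b)
    factor = solve-∀

  [1+k]*[2k]C[1+k]≡k*[2k]Ck : ∀ k → suc k * ((k + k) C suc k) ≡ k * ((k + k) C k)
  [1+k]*[2k]C[1+k]≡k*[2k]Ck k = +-cancelʳ-≡ (k * X) _ _ (begin-equality
    suc k * ((k + k) C suc k) + k * X ≡⟨ [1+k]*nC[1+k]+k*nCk≡n*nCk (k + k) k ⟩
    (k + k) * X                       ≡⟨ *-distribʳ-+ X k k ⟩
    k * X + k * X                     ∎)
    where X = (k + k) C k

  [1+k]*[1+2k]C[1+k]≡[1+2k]*[2k]Ck :
    ∀ k → suc k * (suc (k + k) C suc k) ≡ suc (k + k) * ((k + k) C k)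
  [1+k]*[1+2k]C[1+k]≡[1+2k]*[2k]Ck k = begin-equality
    suc k * (suc (k + k) C suc k)
      ≡⟨ cong (suc k *_) (nCk+nC[k+1]≡[n+1]C[k+1] (k + k) k) ⟨
    suc k * (X + (k + k) C suc k)
      ≡⟨ *-distribˡ-+ (suc k) X _ ⟩
    suc k * X + suc k * ((k + k) C suc k)
      ≡⟨ cong (suc k * X +_) ([1+k]*[2k]C[1+k]≡k*[2k]Ck k) ⟩
    suc k * X + k * X
      ≡⟨ *-distribʳ-+ X (suc k) k ⟨
    suc (k + k) * X ∎
    where X = (k + k) C k

  [2+2k]C[1+k]≡2*[1+2k]C[1+k] : ∀ k → suc (suc (k + k)) C suc k ≡ 2 * (suc (k + k) C suc k)
  [2+2k]C[1+k]≡2*[1+2k]C[1+k] k = begin-equality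
    suc (suc (k + k)) C suc k    ≡⟨ nCk+nC[k+1]≡[n+1]C[k+1] (suc (k + k)) k ⟨
    suc (k + k) C k + Y          ≡⟨ cong (_+ Y) symmetry ⟩
    Y + Y                        ≡⟨ cong (Y +_) (+-identityʳ Y) ⟨
    2 * Y                        ∎
    where
    Y = suc (k + k) C suc k
    symmetry : suc (k + k) C k ≡ Y
    symmetry = trans (nCk≡nC[n∸k] (m≤n+m k (suc k))) (cong (suc (k + k) C_) (m+n∸n≡m (suc k) k))

  central-binomial-step : ∀ k X Z → suc k * Z ≡ 2 * (suc (k + k) * X) →
    X * X * suc (k + k) ≤ 4 ^ (k + k) → Z * Z * (3 + (k + k)) ≤ 4 * (4 * 4 ^ (k + k))
  central-binomial-step k X Z ratio X-bound = *-cancelˡ-≤ (suc k * suc k) (begin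
    suc k * suc k * (Z * Z * c₃)               ≡⟨ square-out (suc k) Z c₃ ⟩
    suc k * Z * (suc k * Z) * c₃               ≡⟨ cong (λ w → w * w * c₃) ratio ⟩
    2 * (c₁ * X) * (2 * (c₁ * X)) * c₃         ≡⟨ rearrange c₁ X c₃ ⟩
    4 * (c₁ * c₃) * (X * X * c₁)               ≤⟨ *-monoʳ-≤ (4 * (c₁ * c₃)) X-bound ⟩
    4 * (c₁ * c₃) * 4 ^ (k + k)                ≤⟨ *-monoˡ-≤ (4 ^ (k + k)) (*-monoʳ-≤ 4 c₁c₃≤[2+2k]²) ⟩
    4 * ((2 + (k + k)) * (2 + (k + k))) * 4 ^ (k + k) ≡⟨ collect k (4 ^ (k + k)) ⟩
    suc k * suc k * (4 * (4 * 4 ^ (k + k)))    ∎)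
    where
    c₁ = suc (k + k)
    c₃ = 3 + (k + k)
    c₁c₃≤[2+2k]² : c₁ * c₃ ≤ (2 + (k + k)) * (2 + (k + k))
    c₁c₃≤[2+2k]² = ≤-trans (n≤1+n (c₁ * c₃)) (≤-reflexive (square-identity k))
      where
      square-identity : ∀ k → 1 + (1 + (k + k)) * (3 + (k + k)) ≡ (2 + (k + k)) * (2 + (k + k))
      square-identity = solve-∀
    square-out : ∀ a Z c → a * a * (Z * Z * c) ≡ a * Z * (a * Z) * c
    square-out = solve-∀
    rearrange : ∀ c₁ X c₃ → 2 * (c₁ * X) * (2 * (c₁ * X)) * c₃ ≡ 4 * (c₁ * c₃) * (X * X * c₁)
    rearrange = solve-∀
    collect : ∀ k q → 4 * ((2 + (k + k)) * (2 + (k + k))) * q ≡ suc k * suc k * (4 * (4 * q))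
    collect = solve-∀

  central-binomial-bound : ∀ k → ((k + k) C k) * ((k + k) C k) * suc (k + k) ≤ 4 ^ (k + k)
  central-binomial-bound zero    = ≤-refl
  central-binomial-bound (suc k) rewrite +-suc k k =
    central-binomial-step k ((k + k) C k) (suc (suc (k + k)) C suc k) ratio (central-binomial-bound k)
    where
    ratio : suc k * (suc (suc (k + k)) C suc k) ≡ 2 * (suc (k + k) * ((k + k) C k))
    ratio = begin-equality
      suc k * (suc (suc (k + k)) C suc k)   ≡⟨ cong (suc k *_) ([2+2k]C[1+k]≡2*[1+2k]C[1+k] k) ⟩
      suc k * (2 * (suc (k + k) C suc k))   ≡⟨ swap (suc k) (suc (k + k) C suc k) ⟩
      2 * (suc k * (suc (k + k) C suc k))   ≡⟨ cong (2 *_) ([1+k]*[1+2k]C[1+k]≡[1+2k]*[2k]Ck k) ⟩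
      2 * (suc (k + k) * ((k + k) C k))     ∎
      where
      swap : ∀ a y → a * (2 * y) ≡ 2 * (a * y)
      swap = solve-∀

  middle-binomial-bound : ∀ m → (m C ⌈ m /2⌉) * (m C ⌈ m /2⌉) * suc m ≤ 4 ^ m
  middle-binomial-bound m with even-or-odd m
  ... | even k rewrite ⌈k+k/2⌉≡k k = central-binomial-bound k
  ... | odd k rewrite sym (n≡⌊n+n/2⌋ k) = *-cancelˡ-≤ 4 (begin
    4 * (Y * Y * (2 + (k + k)))  ≡⟨ double-square Y (2 + (k + k)) ⟩
    2 * Y * (2 * Y) * (2 + (k + k))
      ≡⟨ cong (λ Z → Z * Z * (2 + (k + k))) ([2+2k]C[1+k]≡2*[1+2k]C[1+k] k) ⟨
    Z * Z * (2 + (k + k))        ≤⟨ *-monoʳ-≤ (Z * Z) (n≤1+n _) ⟩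
    Z * Z * (3 + (k + k))        ≤⟨ subst (λ j → (j C suc k) * (j C suc k) * suc j ≤ 4 ^ j)
                                          (cong suc (+-suc k k)) (central-binomial-bound (suc k)) ⟩
    4 * 4 ^ suc (k + k)          ∎)
    where
    Y = suc (k + k) C suc k
    Z = suc (suc (k + k)) C suc k
    double-square : ∀ y c → 4 * (y * y * c) ≡ 2 * y * (2 * y) * c
    double-square = solve-∀

module Powers where
  open import Data.Nat
  open import Data.Nat.Properties
  open import Data.Nat.Tactic.RingSolver using (solve-∀)

  ^-distribʳ-* : ∀ a b k → (a * b) ^ k ≡ a ^ k * b ^ k
  ^-distribʳ-* a b zero    = refl
  ^-distribʳ-* a b (suc k) =
    trans (cong (a * b *_) (^-distribʳ-* a b k)) (interchange a b (a ^ k) (b ^ k))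
    where
    interchange : ∀ a b x y → a * b * (x * y) ≡ a * x * (b * y)
    interchange = solve-∀

  n≤2^n : ∀ n → n ≤ 2 ^ n
  n≤2^n zero    = z≤n
  n≤2^n (suc n) = ≤-trans (+-mono-≤ (m^n>0 2 n) (n≤2^n n))
                          (≤-reflexive (cong (2 ^ n +_) (sym (+-identityʳ (2 ^ n)))))

  [p^r]^d≤m : ∀ p d r {m} → 2 ^ (p * d * r) ≤ m → (p ^ r) ^ d ≤ m
  [p^r]^d≤m p d r 2^pdr≤m = begin
    (p ^ r) ^ d        ≡⟨ ^-*-assoc p r d ⟩
    p ^ (r * d)        ≤⟨ ^-monoˡ-≤ (r * d) (n≤2^n p) ⟩
    (2 ^ p) ^ (r * d)  ≡⟨ ^-*-assoc 2 p (r * d) ⟩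
    2 ^ (p * (r * d))  ≡⟨ cong (2 ^_) (reorder p d r) ⟩
    2 ^ (p * d * r)    ≤⟨ 2^pdr≤m ⟩
    _                  ∎
    where
    open ≤-Reasoning
    reorder : ∀ p d r → p * (r * d) ≡ p * d * r
    reorder = solve-∀

  square-bound-to-power : ∀ d W {D n P m} → D * D * n ≤ P * (W * W) → P ^ d ≤ m →
    D ^ (2 * d) * n ^ d ≤ (2 * W) ^ (2 * d) * m
  square-bound-to-power d W {D} {n} {P} {m} D²n≤PW² P^d≤m = begin
    D ^ (2 * d) * n ^ d             ≡⟨ cong (_* n ^ d) (^-square D d) ⟩
    (D * D) ^ d * n ^ d             ≡⟨ ^-distribʳ-* (D * D) n d ⟨
    (D * D * n) ^ d                 ≤⟨ ^-monoˡ-≤ d D²n≤PW² ⟩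
    (P * (W * W)) ^ d               ≡⟨ ^-distribʳ-* P (W * W) d ⟩
    P ^ d * (W * W) ^ d             ≤⟨ *-mono-≤ P^d≤m (^-monoˡ-≤ d (*-mono-≤ (m≤n*m W 2) (m≤n*m W 2))) ⟩
    m * (2 * W * (2 * W)) ^ d       ≡⟨ *-comm m _ ⟩
    (2 * W * (2 * W)) ^ d * m       ≡⟨ cong (_* m) (^-square (2 * W) d) ⟨
    (2 * W) ^ (2 * d) * m           ∎
    where
    open ≤-Reasoning
    ^-square : ∀ x k → x ^ (2 * k) ≡ (x * x) ^ k
    ^-square x k = trans (sym (^-*-assoc x 2 k)) (cong (λ y → (x * y) ^ k) (*-identityʳ x))

module Fourier where
  open Sums
  open Enumeration
  open import Data.Nat using (ℕ; zero; suc; _^_)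
  open import Data.Nat.Properties using (m^n>0)
  open import Data.Integer using (ℤ; +_; 0ℤ; 1ℤ; -1ℤ; _+_; _*_; _≤_; +<+; positive; nonNegative)
  open import Data.Integer.Properties hiding (_≟_)
  open import Data.Integer.Tactic.RingSolver using (solve-∀)
  open import Algebra.Properties.CommutativeSemigroup *-commutativeSemigroup using (x∙yz≈y∙xz)
  import Data.Bool.Properties as Bool
  open import Data.Vec using (zipWith)
  open import Data.Vec.Properties using (≡-dec)
  open import Relation.Binary.Definitions using (DecidableEquality)
  open ≤-Reasoning

  private
    variable
      n : ℕ

  -1^_ : Bool → ℤ
  -1^ false = 1ℤ
  -1^ true  = -1ℤ

  -1^-∧-xor : ∀ a b c → -1^ (a ∧ (b xor c)) ≡ -1^ (a ∧ b) * -1^ (a ∧ c)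
  -1^-∧-xor false b     c     = refl
  -1^-∧-xor true  false false = refl
  -1^-∧-xor true  false true  = refl
  -1^-∧-xor true  true  false = refl
  -1^-∧-xor true  true  true  = refl

  _≟_ : DecidableEquality (Vec Bool n)
  _≟_ = ≡-dec Bool._≟_

  1+-1^b*-1^c≡2*𝟙[b≟c] : ∀ b c → 1ℤ + -1^ b * -1^ c ≡ + 2 * 𝟙 (b Bool.≟ c)
  1+-1^b*-1^c≡2*𝟙[b≟c] false false = refl
  1+-1^b*-1^c≡2*𝟙[b≟c] false true  = refl
  1+-1^b*-1^c≡2*𝟙[b≟c] true  false = refl
  1+-1^b*-1^c≡2*𝟙[b≟c] true  true  = refl

  χ : Vec Bool n → Vec Bool n → ℤ
  χ []      []      = 1ℤ
  χ (a ∷ α) (b ∷ x) = -1^ (a ∧ b) * χ α x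

  _⊕_ : Vec Bool n → Vec Bool n → Vec Bool n
  _⊕_ = zipWith _xor_

  χ-⊕ : (α x y : Vec Bool n) → χ α (x ⊕ y) ≡ χ α x * χ α y
  χ-⊕ []      []      []      = refl
  χ-⊕ (a ∷ α) (b ∷ x) (c ∷ y) = begin-equality
    -1^ (a ∧ (b xor c)) * χ α (x ⊕ y)
      ≡⟨ cong₂ _*_ (-1^-∧-xor a b c) (χ-⊕ α x y) ⟩
    -1^ (a ∧ b) * -1^ (a ∧ c) * (χ α x * χ α y)
      ≡⟨ interchange (-1^ (a ∧ b)) (-1^ (a ∧ c)) (χ α x) (χ α y) ⟩
    -1^ (a ∧ b) * χ α x * (-1^ (a ∧ c) * χ α y) ∎
    where
    interchange : ∀ s t X Y → s * t * (X * Y) ≡ s * X * (t * Y)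
    interchange = solve-∀

  cube≡vectors : ∀ n → cube n ≡ vectors (false ∷ true ∷ []) n
  cube≡vectors zero    = refl
  cube≡vectors (suc n) = cong (concatMap _) (cube≡vectors n)

  ∑-cube-suc : (f : Vec Bool (suc n) → ℤ) →
               ∑ (cube (suc n)) f ≡ ∑[ v ∈ cube n ] (f (false ∷ v) + f (true ∷ v))
  ∑-cube-suc {n} f = trans (∑-concatMap _ (cube n) f)
    (∑-cong (cube n) (λ v → cong (_+_ (f (false ∷ v))) (+-identityʳ (f (true ∷ v)))))

  ∑-cube-1 : ∀ n → ∑[ _ ∈ cube n ] 1ℤ ≡ + (2 ^ n)
  ∑-cube-1 n = begin-equality
    ∑[ _ ∈ cube n ] 1ℤ                    ≡⟨ ∑-1 (cube n) ⟩
    + length (cube n)                     ≡⟨ cong (λ c → + length c) (cube≡vectors n) ⟩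
    + length (vectors (false ∷ true ∷ []) n) ≡⟨ cong +_ (length-vectors (false ∷ true ∷ []) n) ⟩
    + (2 ^ n)                             ∎

  sifting-cube : Sifting _≟_ (cube n)
  sifting-cube {n} rewrite cube≡vectors n = sifting-vectors sifting-bits n
    where
    sifting-bits : Sifting Bool._≟_ (false ∷ true ∷ [])
    sifting-bits h false = first (h false) (h true)
      where
      first : ∀ a b → a * 1ℤ + (b * 0ℤ + 0ℤ) ≡ a
      first = solve-∀
    sifting-bits h true = second (h false) (h true)
      where
      second : ∀ a b → a * 0ℤ + (b * 1ℤ + 0ℤ) ≡ b
      second = solve-∀

  orthogonality : (x y : Vec Bool n) → ∑[ α ∈ cube n ] (χ α x * χ α y) ≡ + (2 ^ n) * 𝟙 (x ≟ y)
  orthogonality []      []      = refl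
  orthogonality {suc n} (b ∷ x) (c ∷ y) = begin-equality
    ∑[ α ∈ cube (suc n) ] (χ α (b ∷ x) * χ α (c ∷ y))
      ≡⟨ ∑-cube-suc (λ α → χ α (b ∷ x) * χ α (c ∷ y)) ⟩
    ∑[ α ∈ cube n ] (1ℤ * χ α x * (1ℤ * χ α y) + -1^ b * χ α x * (-1^ c * χ α y))
      ≡⟨ ∑-cong (cube n) (λ α → factor (-1^ b) (-1^ c) (χ α x) (χ α y)) ⟩
    ∑[ α ∈ cube n ] ((1ℤ + -1^ b * -1^ c) * (χ α x * χ α y))
      ≡⟨ *-distribˡ-∑ (1ℤ + -1^ b * -1^ c) (cube n) _ ⟨
    (1ℤ + -1^ b * -1^ c) * ∑[ α ∈ cube n ] (χ α x * χ α y)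
      ≡⟨ cong₂ _*_ (1+-1^b*-1^c≡2*𝟙[b≟c] b c) (orthogonality x y) ⟩
    + 2 * 𝟙 (b Bool.≟ c) * (+ (2 ^ n) * 𝟙 (x ≟ y))
      ≡⟨ interchange (+ 2) (𝟙 (b Bool.≟ c)) (+ (2 ^ n)) (𝟙 (x ≟ y)) ⟩
    + 2 * + (2 ^ n) * (𝟙 (b Bool.≟ c) * 𝟙 (x ≟ y))
      ≡⟨ cong₂ _*_ (pos-* 2 (2 ^ n)) (𝟙-×-dec (b Bool.≟ c) (x ≟ y)) ⟨
    + (2 ^ suc n) * 𝟙 ((b ∷ x) ≟ (c ∷ y)) ∎
    where
    factor : ∀ s t X Y → 1ℤ * X * (1ℤ * Y) + s * X * (t * Y) ≡ (1ℤ + s * t) * (X * Y)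
    factor = solve-∀
    interchange : ∀ a b c d → a * b * (c * d) ≡ a * c * (b * d)
    interchange = solve-∀

  -- Unnormalised: inversion and Parseval carry a factor 2 ^ n.
  hat : (Vec Bool n → ℤ) → Vec Bool n → ℤ
  hat {n} f α = ∑[ x ∈ cube n ] (f x * χ α x)

  ‖_‖² : (Vec Bool n → ℤ) → ℤ
  ‖_‖² {n} f = ∑[ x ∈ cube n ] (f x * f x)

  ⟨_∣_∣_⟩ : (Vec Bool n → ℤ) → (Vec Bool n → ℤ) → (Vec Bool n → ℤ) → ℤ
  ⟨_∣_∣_⟩ {n} u f t = ∑[ x ∈ cube n ] ∑[ y ∈ cube n ] (u x * f (x ⊕ y) * t y)

  ∑-hat : (f h : Vec Bool n → ℤ) →
          ∑[ α ∈ cube n ] (hat f α * h α) ≡ ∑[ x ∈ cube n ] (f x * ∑[ α ∈ cube n ] (χ α x * h α))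
  ∑-hat {n} f h = begin-equality
    ∑[ α ∈ cube n ] (hat f α * h α)
      ≡⟨ ∑-cong (cube n) (λ α → *-distribʳ-∑ (h α) (cube n) _) ⟩
    ∑[ α ∈ cube n ] ∑[ x ∈ cube n ] (f x * χ α x * h α)
      ≡⟨ ∑-comm (cube n) (cube n) _ ⟩
    ∑[ x ∈ cube n ] ∑[ α ∈ cube n ] (f x * χ α x * h α)
      ≡⟨ ∑-cong (cube n) (λ x → trans (∑-cong (cube n) (λ α → *-assoc (f x) (χ α x) (h α)))
                                      (sym (*-distribˡ-∑ (f x) (cube n) _))) ⟩
    ∑[ x ∈ cube n ] (f x * ∑[ α ∈ cube n ] (χ α x * h α)) ∎

  fourier-inversion : (f : Vec Bool n → ℤ) (w : Vec Bool n) →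
                      ∑[ α ∈ cube n ] (hat f α * χ α w) ≡ + (2 ^ n) * f w
  fourier-inversion {n} f w = begin-equality
    ∑[ α ∈ cube n ] (hat f α * χ α w)
      ≡⟨ ∑-hat f (λ α → χ α w) ⟩
    ∑[ x ∈ cube n ] (f x * ∑[ α ∈ cube n ] (χ α x * χ α w))
      ≡⟨ ∑-cong (cube n) (λ x → cong (f x *_) (orthogonality x w)) ⟩
    ∑[ x ∈ cube n ] (f x * (+ (2 ^ n) * 𝟙 (x ≟ w)))
      ≡⟨ ∑-cong (cube n) (λ x → x∙yz≈y∙xz (f x) (+ (2 ^ n)) (𝟙 (x ≟ w))) ⟩
    ∑[ x ∈ cube n ] (+ (2 ^ n) * (f x * 𝟙 (x ≟ w)))
      ≡⟨ *-distribˡ-∑ (+ (2 ^ n)) (cube n) _ ⟨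
    + (2 ^ n) * ∑[ x ∈ cube n ] (f x * 𝟙 (x ≟ w))
      ≡⟨ cong (+ (2 ^ n) *_) (sifting-cube f w) ⟩
    + (2 ^ n) * f w ∎

  parseval : (f : Vec Bool n → ℤ) → ∑[ α ∈ cube n ] (hat f α * hat f α) ≡ + (2 ^ n) * ‖ f ‖²
  parseval {n} f = begin-equality
    ∑[ α ∈ cube n ] (hat f α * hat f α)
      ≡⟨ ∑-hat f (hat f) ⟩
    ∑[ x ∈ cube n ] (f x * ∑[ α ∈ cube n ] (χ α x * hat f α))
      ≡⟨ ∑-cong (cube n) (λ x → cong (f x *_) (trans
           (∑-cong (cube n) (λ α → *-comm (χ α x) (hat f α))) (fourier-inversion f x))) ⟩
    ∑[ x ∈ cube n ] (f x * (+ (2 ^ n) * f x))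
      ≡⟨ ∑-cong (cube n) (λ x → x∙yz≈y∙xz (f x) (+ (2 ^ n)) (f x)) ⟩
    ∑[ x ∈ cube n ] (+ (2 ^ n) * (f x * f x))
      ≡⟨ *-distribˡ-∑ (+ (2 ^ n)) (cube n) _ ⟨
    + (2 ^ n) * ‖ f ‖² ∎

  convolution-identity : (u f t : Vec Bool n → ℤ) →
    ∑[ α ∈ cube n ] (hat u α * (hat t α * hat f α)) ≡ + (2 ^ n) * ⟨ u ∣ f ∣ t ⟩
  convolution-identity {n} u f t = begin-equality
    ∑[ α ∈ cube n ] (hat u α * (hat t α * hat f α))
      ≡⟨ ∑-hat u (λ α → hat t α * hat f α) ⟩
    ∑[ x ∈ cube n ] (u x * ∑[ α ∈ cube n ] (χ α x * (hat t α * hat f α)))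
      ≡⟨ ∑-cong (cube n) (λ x → cong (u x *_) (begin-equality
           ∑[ α ∈ cube n ] (χ α x * (hat t α * hat f α))
             ≡⟨ ∑-cong (cube n) (λ α → x∙yz≈y∙xz (χ α x) (hat t α) (hat f α)) ⟩
           ∑[ α ∈ cube n ] (hat t α * (χ α x * hat f α))
             ≡⟨ ∑-hat t (λ α → χ α x * hat f α) ⟩
           ∑[ y ∈ cube n ] (t y * ∑[ α ∈ cube n ] (χ α y * (χ α x * hat f α)))
             ≡⟨ ∑-cong (cube n) (λ y → cong (t y *_) (trans
                  (∑-cong (cube n) (λ α → trans (swap (χ α y) (χ α x) (hat f α))
                                                 (cong (hat f α *_) (sym (χ-⊕ α x y)))))
                  (fourier-inversion f (x ⊕ y)))) ⟩
           ∑[ y ∈ cube n ] (t y * (+ (2 ^ n) * f (x ⊕ y))) ∎)) ⟩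
    ∑[ x ∈ cube n ] (u x * ∑[ y ∈ cube n ] (t y * (+ (2 ^ n) * f (x ⊕ y))))
      ≡⟨ ∑-cong (cube n) (λ x → trans (*-distribˡ-∑ (u x) (cube n) _)
           (∑-cong (cube n) (λ y → rearrange (u x) (t y) (+ (2 ^ n)) (f (x ⊕ y))))) ⟩
    ∑[ x ∈ cube n ] ∑[ y ∈ cube n ] (+ (2 ^ n) * (u x * f (x ⊕ y) * t y))
      ≡⟨ *-distribˡ-∑∑ (+ (2 ^ n)) (cube n) (cube n) _ ⟨
    + (2 ^ n) * ⟨ u ∣ f ∣ t ⟩ ∎
    where
    swap : ∀ c d F → c * (d * F) ≡ F * (d * c)
    swap = solve-∀
    rearrange : ∀ a b P F → a * (b * (P * F)) ≡ P * (a * F * b)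
    rearrange = solve-∀

  module _ (f : Vec Bool n → ℤ) (m Q : ℕ) (spectrum-bound : ∀ α → hat f α * hat f α * + m ≤ + Q) where

    ∑-hat-*-hat-bound : (u : Vec Bool n → ℤ) →
      ∑[ α ∈ cube n ] (hat u α * hat f α * (hat u α * hat f α)) * + m ≤ + Q * (+ (2 ^ n) * ‖ u ‖²)
    ∑-hat-*-hat-bound u = begin
      ∑[ α ∈ cube n ] (hat u α * hat f α * (hat u α * hat f α)) * + m
        ≡⟨ *-distribʳ-∑ (+ m) (cube n) _ ⟩
      ∑[ α ∈ cube n ] (hat u α * hat f α * (hat u α * hat f α) * + m)
        ≡⟨ ∑-cong (cube n) (λ α → rearrange (hat u α) (hat f α) (+ m)) ⟩
      ∑[ α ∈ cube n ] (hat f α * hat f α * + m * (hat u α * hat u α))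
        ≤⟨ ∑-mono-≤ (cube n) (λ α →
             *-monoʳ-≤-nonNeg (hat u α * hat u α) {{nonNegative (0≤x*x (hat u α))}} (spectrum-bound α)) ⟩
      ∑[ α ∈ cube n ] (+ Q * (hat u α * hat u α))
        ≡⟨ *-distribˡ-∑ (+ Q) (cube n) _ ⟨
      + Q * ∑[ α ∈ cube n ] (hat u α * hat u α)
        ≡⟨ cong (+ Q *_) (parseval u) ⟩
      + Q * (+ (2 ^ n) * ‖ u ‖²) ∎
      where
      rearrange : ∀ a b m → a * b * (a * b) * m ≡ b * b * m * (a * a)
      rearrange = solve-∀

    bilinear-bound : (u t : Vec Bool n → ℤ) →
      ⟨ u ∣ f ∣ t ⟩ * ⟨ u ∣ f ∣ t ⟩ * + m ≤ + Q * (‖ u ‖² * ‖ t ‖²)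
    bilinear-bound u t = cancel (cancel (begin
      P * (P * (B * B * + m))     ≡⟨ square-out P B (+ m) ⟩
      P * B * (P * B) * + m       ≡⟨ cong (λ z → z * z * + m) spectral-form ⟨
      S * S * + m                 ≤⟨ *-monoʳ-≤-nonNeg (+ m) (cauchy-schwarz (cube n) g (hat t)) ⟩
      G * T * + m                 ≡⟨ swap G T (+ m) ⟩
      G * + m * T                 ≤⟨ *-monoʳ-≤-nonNeg T {{nonNegative 0≤T}} (∑-hat-*-hat-bound u) ⟩
      + Q * (P * ‖ u ‖²) * T      ≡⟨ cong (+ Q * (P * ‖ u ‖²) *_) (parseval t) ⟩
      + Q * (P * ‖ u ‖²) * (P * ‖ t ‖²) ≡⟨ collect (+ Q) P ‖ u ‖² ‖ t ‖² ⟩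
      P * (P * (+ Q * (‖ u ‖² * ‖ t ‖²))) ∎))
      where
      P = + (2 ^ n)
      B = ⟨ u ∣ f ∣ t ⟩
      g : Vec Bool n → ℤ
      g α = hat u α * hat f α
      S = ∑[ α ∈ cube n ] (g α * hat t α)
      G = ∑[ α ∈ cube n ] (g α * g α)
      T = ∑[ α ∈ cube n ] (hat t α * hat t α)
      0≤T : 0ℤ ≤ T
      0≤T = ∑-nonneg (cube n) (λ α → 0≤x*x (hat t α))
      spectral-form : S ≡ P * B
      spectral-form = trans (∑-cong (cube n) (λ α → *-assoc (hat u α) (hat f α) (hat t α)))
        (trans (∑-cong (cube n) (λ α → cong (hat u α *_) (*-comm (hat f α) (hat t α))))
               (convolution-identity u f t))
      cancel : ∀ {i j} → P * i ≤ P * j → i ≤ j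
      cancel {i} {j} = *-cancelˡ-≤-pos i j P {{positive (+<+ (m^n>0 2 n))}}
      square-out : ∀ P B m → P * (P * (B * B * m)) ≡ P * B * (P * B) * m
      square-out = solve-∀
      swap : ∀ G T m → G * T * m ≡ G * m * T
      swap = solve-∀
      collect : ∀ Q P U T → Q * (P * U) * (P * T) ≡ P * (P * (Q * (U * T)))
      collect = solve-∀

module Threshold where
  open Sums
  open Fourier
  open Binomial
    using (EvenOrOdd; even; odd; even-or-odd; ⌈k+k/2⌉≡k; central-binomial-bound; middle-binomial-bound)
  open import Data.Nat as ℕ using (ℕ; zero; suc; pred; _^_; _<ᵇ_; ⌊_/2⌋; ⌈_/2⌉)
  import Data.Nat.Properties as ℕ
  open import Data.Nat.Combinatorics using (_C_; nCk+nC[k+1]≡[n+1]C[k+1])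
  open import Data.Integer using (ℤ; +_; 0ℤ; 1ℤ; -1ℤ; _+_; _-_; -_; _*_; _≤_; ∣_∣; +≤+)
  open import Data.Integer.Properties hiding (_≟_)
  open import Data.Integer.Tactic.RingSolver using (solve-∀)
  open import Data.Nat.Tactic.RingSolver using () renaming (solve-∀ to ℕ-solve-∀)
  open import Data.Bool.Properties using (∧-zeroʳ; ∧-identityʳ)
  open import Data.Vec using (replicate)
  open import Data.Vec.Relation.Unary.Any using (Any; here; there)
  open import Data.Sum using (_⊎_; inj₁; inj₂)

  private
    variable
      n : ℕ

  ±1 : Bool → ℤ
  ±1 true  = 1ℤ
  ±1 false = -1ℤ

  weight : Vec Bool n → ℕ
  weight []      = 0
  weight (b ∷ z) = (if b then 1 else 0) ℕ.+ weight z

  threshold : ℕ → Vec Bool n → ℤ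
  threshold T z = ±1 (weight z <ᵇ T)

  threshold-true∷ : ∀ T (v : Vec Bool n) → threshold T (true ∷ v) ≡ threshold (pred T) v
  threshold-true∷ zero    v = refl
  threshold-true∷ (suc T) v = refl

  hat-threshold-∷ : ∀ T a (α : Vec Bool n) →
    hat (threshold T) (a ∷ α) ≡ hat (threshold T) α + -1^ a * hat (threshold (pred T)) α
  hat-threshold-∷ {n} T a α = begin
    hat (threshold T) (a ∷ α)
      ≡⟨ ∑-cube-suc (λ x → threshold T x * χ (a ∷ α) x) ⟩
    ∑[ v ∈ cube n ] (threshold T v * (-1^ (a ∧ false) * χ α v)
                     + threshold T (true ∷ v) * (-1^ (a ∧ true) * χ α v))
      ≡⟨ ∑-cong (cube n) split ⟩
    ∑[ v ∈ cube n ] (threshold T v * χ α v + -1^ a * (threshold (pred T) v * χ α v))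
      ≡⟨ ∑-distrib-+ (cube n) _ _ ⟩
    hat (threshold T) α + ∑[ v ∈ cube n ] (-1^ a * (threshold (pred T) v * χ α v))
      ≡⟨ cong (_+_ (hat (threshold T) α)) (*-distribˡ-∑ (-1^ a) (cube n) _) ⟨
    hat (threshold T) α + -1^ a * hat (threshold (pred T)) α ∎
    where
    open ≡-Reasoning
    pull-sign : ∀ x y c s → x * (1ℤ * c) + y * (s * c) ≡ x * c + s * (y * c)
    pull-sign = solve-∀
    split : ∀ v → threshold T v * (-1^ (a ∧ false) * χ α v)
                  + threshold T (true ∷ v) * (-1^ (a ∧ true) * χ α v)
                ≡ threshold T v * χ α v + -1^ a * (threshold (pred T) v * χ α v)
    split v rewrite ∧-zeroʳ a | ∧-identityʳ a | threshold-true∷ T v =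
      pull-sign (threshold T v) (threshold (pred T) v) (χ α v) (-1^ a)

  ∣-1^a*x∣≡∣x∣ : ∀ a x → ∣ -1^ a * x ∣ ≡ ∣ x ∣
  ∣-1^a*x∣≡∣x∣ false x = cong ∣_∣ (*-identityˡ x)
  ∣-1^a*x∣≡∣x∣ true  x = trans (cong ∣_∣ (-1*i≡-i x)) (∣-i∣≡∣i∣ x)

  ∣x+-1^a*y∣≤∣x∣+∣y∣ : ∀ x a y → ∣ x + -1^ a * y ∣ ℕ.≤ ∣ x ∣ ℕ.+ ∣ y ∣
  ∣x+-1^a*y∣≤∣x∣+∣y∣ x a y =
    subst (λ k → ∣ x + -1^ a * y ∣ ℕ.≤ ∣ x ∣ ℕ.+ k) (∣-1^a*x∣≡∣x∣ a y) (∣i+j∣≤∣i∣+∣j∣ x (-1^ a * y))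

  threshold-step-bound : ∀ n t (α : Vec Bool n) →
    ∣ hat (threshold (suc t)) α - hat (threshold t) α ∣ ℕ.≤ 2 ℕ.* (n C t)
  threshold-step-bound zero    zero    [] = ℕ.≤-refl
  threshold-step-bound zero    (suc t) [] = ℕ.z≤n
  threshold-step-bound (suc n) zero    (a ∷ α)
    rewrite hat-threshold-∷ 1 a α | hat-threshold-∷ 0 a α =
      subst (ℕ._≤ 2) (cong ∣_∣ (sym (cancel-sign (hat (threshold 1) α) (hat (threshold 0) α) (-1^ a))))
            (threshold-step-bound n 0 α)
    where
    cancel-sign : ∀ A B s → A + s * B - (B + s * B) ≡ A - B
    cancel-sign = solve-∀
  threshold-step-bound (suc n) (suc t) (a ∷ α)
    rewrite hat-threshold-∷ (2 ℕ.+ t) a α | hat-threshold-∷ (suc t) a α = begin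
      ∣ h₂ + s * h₁ - (h₁ + s * h₀) ∣       ≡⟨ cong ∣_∣ (split h₂ h₁ h₀ s) ⟩
      ∣ (h₂ - h₁) + s * (h₁ - h₀) ∣         ≤⟨ ∣x+-1^a*y∣≤∣x∣+∣y∣ (h₂ - h₁) a (h₁ - h₀) ⟩
      ∣ h₂ - h₁ ∣ ℕ.+ ∣ h₁ - h₀ ∣           ≤⟨ ℕ.+-mono-≤ (threshold-step-bound n (suc t) α)
                                                           (threshold-step-bound n t α) ⟩
      2 ℕ.* (n C (suc t)) ℕ.+ 2 ℕ.* (n C t)   ≡⟨ ℕ.*-distribˡ-+ 2 (n C (suc t)) (n C t) ⟨
      2 ℕ.* (n C (suc t) ℕ.+ n C t)           ≡⟨ cong (2 ℕ.*_) (trans (ℕ.+-comm (n C (suc t)) (n C t))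
                                                                    (nCk+nC[k+1]≡[n+1]C[k+1] n t)) ⟩
      2 ℕ.* (suc n C (suc t))                 ∎
    where
    open ℕ.≤-Reasoning
    h₂ = hat (threshold (2 ℕ.+ t)) α
    h₁ = hat (threshold (suc t)) α
    h₀ = hat (threshold t) α
    s = -1^ a
    split : ∀ A B C s → A + s * B - (B + s * C) ≡ (A - B) + s * (B - C)
    split = solve-∀

  2*nC[1+t]+2*nCt≡2*[1+n]C[1+t] : ∀ n t → 2 ℕ.* (n C (suc t)) ℕ.+ 2 ℕ.* (n C t) ≡ 2 ℕ.* (suc n C (suc t))
  2*nC[1+t]+2*nCt≡2*[1+n]C[1+t] n t = begin
    2 ℕ.* (n C (suc t)) ℕ.+ 2 ℕ.* (n C t) ≡⟨ ℕ.*-distribˡ-+ 2 (n C (suc t)) (n C t) ⟨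
    2 ℕ.* (n C (suc t) ℕ.+ n C t)         ≡⟨ cong (2 ℕ.*_) (ℕ.+-comm (n C (suc t)) (n C t)) ⟩
    2 ℕ.* (n C t ℕ.+ n C (suc t))         ≡⟨ cong (2 ℕ.*_) (nCk+nC[k+1]≡[n+1]C[k+1] n t) ⟩
    2 ℕ.* (suc n C (suc t))               ∎
    where open ≡-Reasoning

  hat-threshold-0-nonzero : (α : Vec Bool n) → Any (_≡ true) α → hat (threshold 0) α ≡ 0ℤ
  hat-threshold-0-nonzero (true ∷ α) (here refl)
    rewrite hat-threshold-∷ 0 true α = cancel (hat (threshold 0) α)
    where
    cancel : ∀ h → h + -1ℤ * h ≡ 0ℤ
    cancel = solve-∀
  hat-threshold-0-nonzero (a ∷ α) (there α≢0)
    rewrite hat-threshold-∷ 0 a α | hat-threshold-0-nonzero α α≢0 =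
      trans (+-identityˡ _) (*-zeroʳ (-1^ a))

  ∣hat-threshold∣-nonzero : ∀ n t (α : Vec Bool (suc n)) → Any (_≡ true) α →
    ∣ hat (threshold (suc t)) α ∣ ℕ.≤ 2 ℕ.* (n C t)
  ∣hat-threshold∣-nonzero n t (true ∷ α) (here refl)
    rewrite hat-threshold-∷ (suc t) true α =
      subst (ℕ._≤ 2 ℕ.* (n C t)) (cong ∣_∣ (minus (hat (threshold (suc t)) α) (hat (threshold t) α)))
            (threshold-step-bound n t α)
    where
    minus : ∀ x y → x - y ≡ x + -1ℤ * y
    minus = solve-∀
  ∣hat-threshold∣-nonzero (suc m) zero (a ∷ α) (there α≢0)
    rewrite hat-threshold-∷ 1 a α | hat-threshold-0-nonzero α α≢0 | *-zeroʳ (-1^ a)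
          | +-identityʳ (hat (threshold 1) α) = ∣hat-threshold∣-nonzero m 0 α α≢0
  ∣hat-threshold∣-nonzero (suc m) (suc t) (a ∷ α) (there α≢0)
    rewrite hat-threshold-∷ (2 ℕ.+ t) a α = begin
      ∣ h₂ + -1^ a * h₁ ∣                    ≤⟨ ∣x+-1^a*y∣≤∣x∣+∣y∣ h₂ a h₁ ⟩
      ∣ h₂ ∣ ℕ.+ ∣ h₁ ∣                      ≤⟨ ℕ.+-mono-≤ (∣hat-threshold∣-nonzero m (suc t) α α≢0)
                                                            (∣hat-threshold∣-nonzero m t α α≢0) ⟩
      2 ℕ.* (m C (suc t)) ℕ.+ 2 ℕ.* (m C t) ≡⟨ 2*nC[1+t]+2*nCt≡2*[1+n]C[1+t] m t ⟩
      2 ℕ.* (suc m C (suc t))               ∎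
    where
    open ℕ.≤-Reasoning
    h₂ = hat (threshold (2 ℕ.+ t)) α
    h₁ = hat (threshold (suc t)) α

  hat-threshold-0-at-0 : ∀ n → hat (threshold 0) (replicate n false) ≡ - + (2 ^ n)
  hat-threshold-0-at-0 zero    = refl
  hat-threshold-0-at-0 (suc n)
    rewrite hat-threshold-∷ 0 false (replicate n false) | hat-threshold-0-at-0 n | pos-* 2 (2 ^ n) =
      double (+ (2 ^ n))
    where
    double : ∀ P → - P + 1ℤ * - P ≡ - (+ 2 * P)
    double = solve-∀

  hat-threshold-above : ∀ n T → n ℕ.< T → hat (threshold T) (replicate n false) ≡ + (2 ^ n)
  hat-threshold-above zero    (suc T) _ = refl
  hat-threshold-above (suc n) (suc T) (ℕ.s≤s n<T)
    rewrite hat-threshold-∷ (suc T) false (replicate n false)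
          | hat-threshold-above n (suc T) (ℕ.m<n⇒m<1+n n<T) | hat-threshold-above n T n<T
          | pos-* 2 (2 ^ n) = double (+ (2 ^ n))
    where
    double : ∀ P → P + 1ℤ * P ≡ + 2 * P
    double = solve-∀

  hat-threshold-antisymmetric : ∀ n T S → T ℕ.+ S ≡ suc n →
    hat (threshold T) (replicate n false) + hat (threshold S) (replicate n false) ≡ 0ℤ
  hat-threshold-antisymmetric zero    zero          (suc zero)    _ = refl
  hat-threshold-antisymmetric zero    (suc zero)    zero          _ = refl
  hat-threshold-antisymmetric zero    zero          (suc (suc S)) ()
  hat-threshold-antisymmetric zero    (suc zero)    (suc S)       ()
  hat-threshold-antisymmetric zero    (suc (suc T)) S             ()
  hat-threshold-antisymmetric (suc n) zero S T+S≡2+n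
    rewrite hat-threshold-0-at-0 (suc n) | hat-threshold-above (suc n) S (ℕ.≤-reflexive (sym T+S≡2+n)) =
      +-inverseˡ (+ (2 ^ suc n))
  hat-threshold-antisymmetric (suc n) (suc T) zero T+S≡2+n
    rewrite hat-threshold-0-at-0 (suc n)
          | hat-threshold-above (suc n) (suc T)
              (ℕ.≤-reflexive (trans (sym T+S≡2+n) (ℕ.+-identityʳ (suc T)))) =
      +-inverseʳ (+ (2 ^ suc n))
  hat-threshold-antisymmetric (suc n) (suc T) (suc S) T+S≡2+n
    rewrite hat-threshold-∷ (suc T) false (replicate n false)
          | hat-threshold-∷ (suc S) false (replicate n false) = begin
      g (suc T) + 1ℤ * g T + (g (suc S) + 1ℤ * g S)  ≡⟨ regroup (g (suc T)) (g T) (g (suc S)) (g S) ⟩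
      (g (suc T) + g S) + (g T + g (suc S))
        ≡⟨ cong₂ _+_ (hat-threshold-antisymmetric n (suc T) S T+S≡1+n)
                     (hat-threshold-antisymmetric n T (suc S) T+S≡1+n′) ⟩
      0ℤ + 0ℤ                                        ≡⟨⟩
      0ℤ                                             ∎
    where
    open ≡-Reasoning
    g : ℕ → ℤ
    g T = hat (threshold T) (replicate n false)
    T+S≡1+n : suc T ℕ.+ S ≡ suc n
    T+S≡1+n = ℕ.suc-injective (trans (cong suc (sym (ℕ.+-suc T S))) T+S≡2+n)
    T+S≡1+n′ : T ℕ.+ suc S ≡ suc n
    T+S≡1+n′ = ℕ.suc-injective T+S≡2+n
    regroup : ∀ a b c d → a + 1ℤ * b + (c + 1ℤ * d) ≡ (a + d) + (b + c)
    regroup = solve-∀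

  x+x≡0⇒∣x∣≡0 : ∀ {x} → x + x ≡ 0ℤ → ∣ x ∣ ≡ 0
  x+x≡0⇒∣x∣≡0 {+ zero} _ = refl

  -- The two middle thresholds have opposite coefficients at α = 0, so for odd n the middle one
  -- vanishes and for even n it is half of a difference bounded by threshold-step-bound.
  ∣hat-threshold∣-at-0 : ∀ n →
    ∣ hat (threshold (suc ⌊ n /2⌋)) (replicate n false) ∣
      ℕ.* ∣ hat (threshold (suc ⌊ n /2⌋)) (replicate n false) ∣ ℕ.* n ℕ.≤ 4 ^ n
  ∣hat-threshold∣-at-0 n with even-or-odd n
  ... | odd k = subst (λ h → h ℕ.* h ℕ.* suc (k ℕ.+ k) ℕ.≤ 4 ^ suc (k ℕ.+ k)) (sym ∣g∣≡0) ℕ.z≤n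
    where
    g = hat (threshold (suc k)) (replicate (suc (k ℕ.+ k)) false)
    ∣g∣≡0 : ∣ hat (threshold (suc ⌈ k ℕ.+ k /2⌉)) (replicate (suc (k ℕ.+ k)) false) ∣ ≡ 0
    ∣g∣≡0 rewrite ⌈k+k/2⌉≡k k = x+x≡0⇒∣x∣≡0 {g}
      (hat-threshold-antisymmetric (suc (k ℕ.+ k)) (suc k) (suc k) (cong suc (ℕ.+-suc k k)))
  ... | even k rewrite sym (ℕ.n≡⌊n+n/2⌋ k) = begin
      ∣ g₁ ∣ ℕ.* ∣ g₁ ∣ ℕ.* (k ℕ.+ k)  ≤⟨ ℕ.*-mono-≤ (ℕ.*-mono-≤ ∣g₁∣≤X ∣g₁∣≤X) (ℕ.n≤1+n (k ℕ.+ k)) ⟩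
      X ℕ.* X ℕ.* suc (k ℕ.+ k)       ≤⟨ central-binomial-bound k ⟩
      4 ^ (k ℕ.+ k)                   ∎
    where
    open ℕ.≤-Reasoning
    X = (k ℕ.+ k) C k
    g₁ = hat (threshold (suc k)) (replicate (k ℕ.+ k) false)
    g₀ = hat (threshold k) (replicate (k ℕ.+ k) false)
    g₁-g₀≡2*g₁ : g₁ - g₀ ≡ + 2 * g₁
    g₁-g₀≡2*g₁ = trans (rearrange g₁ g₀) (trans
      (cong (λ z → + 2 * g₁ - z) (hat-threshold-antisymmetric (k ℕ.+ k) (suc k) k refl))
      (+-identityʳ (+ 2 * g₁)))
      where
      rearrange : ∀ a b → a - b ≡ + 2 * a - (a + b)
      rearrange = solve-∀
    ∣g₁∣≤X : ∣ g₁ ∣ ℕ.≤ X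
    ∣g₁∣≤X = ℕ.*-cancelˡ-≤ 2 (subst (ℕ._≤ 2 ℕ.* X) (trans (cong ∣_∣ g₁-g₀≡2*g₁) (∣i*j∣≡∣i∣*∣j∣ (+ 2) g₁))
                                   (threshold-step-bound (k ℕ.+ k) k (replicate (k ℕ.+ k) false)))

  nonzero-or-zero : (α : Vec Bool n) → Any (_≡ true) α ⊎ α ≡ replicate n false
  nonzero-or-zero []          = inj₂ refl
  nonzero-or-zero (true ∷ α)  = inj₁ (here refl)
  nonzero-or-zero (false ∷ α) with nonzero-or-zero α
  ... | inj₁ α≢0 = inj₁ (there α≢0)
  ... | inj₂ refl = inj₂ refl

  ∣hat-threshold∣-bound : ∀ n (α : Vec Bool n) →
    ∣ hat (threshold (suc ⌊ n /2⌋)) α ∣ ℕ.* ∣ hat (threshold (suc ⌊ n /2⌋)) α ∣ ℕ.* n ℕ.≤ 4 ^ n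
  ∣hat-threshold∣-bound n α with nonzero-or-zero α
  ∣hat-threshold∣-bound n       .(replicate n false) | inj₂ refl = ∣hat-threshold∣-at-0 n
  ∣hat-threshold∣-bound (suc m) α                    | inj₁ α≢0 = begin
    ∣ h ∣ ℕ.* ∣ h ∣ ℕ.* suc m          ≤⟨ ℕ.*-monoˡ-≤ (suc m) (ℕ.*-mono-≤ ∣h∣≤2X ∣h∣≤2X) ⟩
    2 ℕ.* X ℕ.* (2 ℕ.* X) ℕ.* suc m    ≡⟨ pull-4 X (suc m) ⟩
    4 ℕ.* (X ℕ.* X ℕ.* suc m)          ≤⟨ ℕ.*-monoʳ-≤ 4 (middle-binomial-bound m) ⟩
    4 ℕ.* 4 ^ m                        ∎
    where
    open ℕ.≤-Reasoning
    h = hat (threshold (suc ⌈ m /2⌉)) α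
    X = m C ⌈ m /2⌉
    ∣h∣≤2X : ∣ h ∣ ℕ.≤ 2 ℕ.* X
    ∣h∣≤2X = ∣hat-threshold∣-nonzero m ⌈ m /2⌉ α α≢0
    pull-4 : ∀ x c → 2 ℕ.* x ℕ.* (2 ℕ.* x) ℕ.* c ≡ 4 ℕ.* (x ℕ.* x ℕ.* c)
    pull-4 = ℕ-solve-∀

  threshold-spectrum-bound : ∀ n (α : Vec Bool n) →
    hat (threshold (suc ⌊ n /2⌋)) α * hat (threshold (suc ⌊ n /2⌋)) α * + n ≤ + (4 ^ n)
  threshold-spectrum-bound n α = subst (_≤ + (4 ^ n)) (sym in-ℕ) (+≤+ (∣hat-threshold∣-bound n α))
    where
    h = hat (threshold (suc ⌊ n /2⌋)) α
    in-ℕ : h * h * + n ≡ + (∣ h ∣ ℕ.* ∣ h ∣ ℕ.* n)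
    in-ℕ = trans (cong (_* + n) (x*x≡∣x∣*∣x∣ h)) (sym (pos-* (∣ h ∣ ℕ.* ∣ h ∣) n))

module Correlation where
  open Sums
  open Enumeration
  open Fourier hiding (_≟_)
  open Threshold using (±1)
  open import Data.Nat using (ℕ; _^_)
  open import Data.Integer using (ℤ; +_; 1ℤ; _*_; _≤_)
  open import Data.Integer.Properties hiding (_≟_)
  open import Data.Integer.Tactic.RingSolver using (solve-∀)
  open import Relation.Binary.Definitions using (DecidableEquality)
  open ≤-Reasoning

  private
    variable
      n : ℕ

  correlation : (A B : Vec Bool n → Vec Bool n → ℤ) → ℤ
  correlation {n} A B = ∑[ x ∈ cube n ] ∑[ y ∈ cube n ] (A x y * B x y)

  ±1*±1≡1 : ∀ b → ±1 b * ±1 b ≡ 1ℤ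
  ±1*±1≡1 true  = refl
  ±1*±1≡1 false = refl

  𝟙*𝟙≡𝟙 : {P : Set} (P? : Dec P) → 𝟙 P? * 𝟙 P? ≡ 𝟙 P?
  𝟙*𝟙≡𝟙 P? with does P?
  ... | true  = refl
  ... | false = refl

  module _ {K : Set} {_≟_ : DecidableEquality K} {ks : List K} (sifting : Sifting _≟_ ks)
           (f : Vec Bool n → ℤ) (m Q : ℕ) (spectrum-bound : ∀ α → hat f α * hat f α * + m ≤ + Q)
           (g : Vec Bool n → K → Bool) (col : Vec Bool n → K) where

    private
      row : K → Vec Bool n → ℤ
      row k x = ±1 (g x k)

      class : K → Vec Bool n → ℤ
      class k y = 𝟙 (k ≟ col y)

      correlation≡∑⟨row∣f∣class⟩ :
        correlation (λ x y → f (x ⊕ y)) (λ x y → ±1 (g x (col y))) ≡ ∑[ k ∈ ks ] ⟨ row k ∣ f ∣ class k ⟩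
      correlation≡∑⟨row∣f∣class⟩ = begin-equality
        ∑[ x ∈ cube n ] ∑[ y ∈ cube n ] (f (x ⊕ y) * ±1 (g x (col y)))
          ≡⟨ ∑-cong (cube n) (λ x → ∑-cong (cube n) (λ y → cong (f (x ⊕ y) *_)
               (sym (sifting (λ k → ±1 (g x k)) (col y))))) ⟩
        ∑[ x ∈ cube n ] ∑[ y ∈ cube n ] (f (x ⊕ y) * ∑[ k ∈ ks ] (row k x * class k y))
          ≡⟨ ∑-cong (cube n) (λ x → ∑-cong (cube n) (λ y → trans (*-distribˡ-∑ (f (x ⊕ y)) ks _)
               (∑-cong ks (λ k → rearrange (f (x ⊕ y)) (row k x) (class k y))))) ⟩
        ∑[ x ∈ cube n ] ∑[ y ∈ cube n ] ∑[ k ∈ ks ] (row k x * f (x ⊕ y) * class k y)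
          ≡⟨ ∑-cong (cube n) (λ x → ∑-comm (cube n) ks _) ⟩
        ∑[ x ∈ cube n ] ∑[ k ∈ ks ] ∑[ y ∈ cube n ] (row k x * f (x ⊕ y) * class k y)
          ≡⟨ ∑-comm (cube n) ks _ ⟩
        ∑[ k ∈ ks ] ⟨ row k ∣ f ∣ class k ⟩ ∎
        where
        rearrange : ∀ F u t → F * (u * t) ≡ u * F * t
        rearrange = solve-∀

      ‖row‖² : ∀ k → ‖ row k ‖² ≡ + (2 ^ n)
      ‖row‖² k = trans (∑-cong (cube n) (λ x → ±1*±1≡1 (g x k))) (∑-cube-1 n)

      ∑‖class‖² : ∑[ k ∈ ks ] ‖ class k ‖² ≡ + (2 ^ n)
      ∑‖class‖² = begin-equality
        ∑[ k ∈ ks ] ∑[ y ∈ cube n ] (class k y * class k y)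
          ≡⟨ ∑-cong ks (λ k → ∑-cong (cube n) (λ y → 𝟙*𝟙≡𝟙 (k ≟ col y))) ⟩
        ∑[ k ∈ ks ] ∑[ y ∈ cube n ] class k y
          ≡⟨ ∑-comm ks (cube n) _ ⟩
        ∑[ y ∈ cube n ] ∑[ k ∈ ks ] class k y
          ≡⟨ ∑-cong (cube n) (λ y → trans (∑-cong ks (λ k → sym (*-identityˡ (class k y))))
                                          (sifting (λ _ → 1ℤ) (col y))) ⟩
        ∑[ y ∈ cube n ] 1ℤ
          ≡⟨ ∑-cube-1 n ⟩
        + (2 ^ n) ∎

    few-columns-correlation-bound :
      let c = correlation (λ x y → f (x ⊕ y)) (λ x y → ±1 (g x (col y))) in
      c * c * + m ≤ + length ks * (+ Q * (+ (2 ^ n) * + (2 ^ n)))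
    few-columns-correlation-bound = begin
      c * c * + m
        ≡⟨ cong (λ z → z * z * + m)
                (trans correlation≡∑⟨row∣f∣class⟩ (∑-cong ks (λ k → sym (*-identityˡ (b k))))) ⟩
      S * S * + m
        ≤⟨ *-monoʳ-≤-nonNeg (+ m) (cauchy-schwarz ks (λ _ → 1ℤ) b) ⟩
      ∑[ _ ∈ ks ] 1ℤ * ∑[ k ∈ ks ] (b k * b k) * + m
        ≡⟨ *-assoc (∑[ _ ∈ ks ] 1ℤ) _ (+ m) ⟩
      ∑[ _ ∈ ks ] 1ℤ * (∑[ k ∈ ks ] (b k * b k) * + m)
        ≡⟨ cong₂ _*_ (∑-1 ks) (*-distribʳ-∑ (+ m) ks _) ⟩
      + length ks * ∑[ k ∈ ks ] (b k * b k * + m)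
        ≤⟨ *-monoˡ-≤-nonNeg (+ length ks)
             (∑-mono-≤ ks (λ k → bilinear-bound f m Q spectrum-bound (row k) (class k))) ⟩
      + length ks * ∑[ k ∈ ks ] (+ Q * (‖ row k ‖² * ‖ class k ‖²))
        ≡⟨ cong (+ length ks *_) (begin-equality
             ∑[ k ∈ ks ] (+ Q * (‖ row k ‖² * ‖ class k ‖²))
               ≡⟨ ∑-cong ks (λ k → cong (λ z → + Q * (z * ‖ class k ‖²)) (‖row‖² k)) ⟩
             ∑[ k ∈ ks ] (+ Q * (+ (2 ^ n) * ‖ class k ‖²))
               ≡⟨ ∑-cong ks (λ k → sym (*-assoc (+ Q) (+ (2 ^ n)) _)) ⟩
             ∑[ k ∈ ks ] (+ Q * + (2 ^ n) * ‖ class k ‖²)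
               ≡⟨ *-distribˡ-∑ (+ Q * + (2 ^ n)) ks _ ⟨
             + Q * + (2 ^ n) * ∑[ k ∈ ks ] ‖ class k ‖²
               ≡⟨ cong (+ Q * + (2 ^ n) *_) ∑‖class‖² ⟩
             + Q * + (2 ^ n) * + (2 ^ n)
               ≡⟨ *-assoc (+ Q) (+ (2 ^ n)) (+ (2 ^ n)) ⟩
             + Q * (+ (2 ^ n) * + (2 ^ n)) ∎) ⟩
      + length ks * (+ Q * (+ (2 ^ n) * + (2 ^ n))) ∎
      where
      c = correlation (λ x y → f (x ⊕ y)) (λ x y → ±1 (g x (col y)))
      b : K → ℤ
      b k = ⟨ row k ∣ f ∣ class k ⟩
      S = ∑[ k ∈ ks ] (1ℤ * b k)

module LowRank where
  open Sums
  open Enumeration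
  open Fourier
  open Threshold using (±1; weight; threshold; threshold-spectrum-bound)
  open Correlation
  open Powers using (^-distribʳ-*)
  open import Data.Nat as ℕ using (ℕ; zero; suc; _^_; _≤ᵇ_; _<ᵇ_; ⌊_/2⌋; NonZero)
  import Data.Nat.Properties as ℕ
  open import Data.Nat.ListAction using (sum)
  open import Data.Nat.DivMod using (_mod_)
  import Data.Fin as Fin
  open import Data.Integer using (ℤ; +_; 0ℤ; 1ℤ; _+_; _*_; _≤_; ∣_∣)
  open import Data.Integer.Properties hiding (_≟_)
  open import Data.Vec using (tabulate; lookup)
  open import Data.Vec.Properties using (lookup∘tabulate; ≡-dec)
  import Data.List.Properties as List
  open ≡-Reasoning

  private
    variable
      n : ℕ

  ∑-allFin-suc : ∀ p (f : Fin (suc p) → ℤ) →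
                 ∑ (allFin (suc p)) f ≡ f Fin.zero + ∑[ i ∈ allFin p ] f (Fin.suc i)
  ∑-allFin-suc p f = cong (_+_ (f Fin.zero))
    (trans (cong (λ is → ∑ is f) (sym (List.map-tabulate (λ i → i) Fin.suc)))
           (∑-map Fin.suc (allFin p) f))

  sifting-allFin : ∀ p → Sifting Fin._≟_ (allFin p)
  sifting-allFin (suc p) h Fin.zero = begin
    ∑[ i ∈ allFin (suc p) ] (h i * 𝟙 (i Fin.≟ Fin.zero))
      ≡⟨ ∑-allFin-suc p (λ i → h i * 𝟙 (i Fin.≟ Fin.zero)) ⟩
    h Fin.zero * 1ℤ + ∑[ i ∈ allFin p ] (h (Fin.suc i) * 0ℤ)
      ≡⟨ cong₂ _+_ (*-identityʳ (h Fin.zero))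
                   (trans (∑-cong (allFin p) (λ i → *-zeroʳ (h (Fin.suc i)))) (∑-zero (allFin p))) ⟩
    h Fin.zero + 0ℤ
      ≡⟨ +-identityʳ (h Fin.zero) ⟩
    h Fin.zero ∎
  sifting-allFin (suc p) h (Fin.suc j) = begin
    ∑[ i ∈ allFin (suc p) ] (h i * 𝟙 (i Fin.≟ Fin.suc j))
      ≡⟨ ∑-allFin-suc p (λ i → h i * 𝟙 (i Fin.≟ Fin.suc j)) ⟩
    h Fin.zero * 0ℤ + ∑[ i ∈ allFin p ] (h (Fin.suc i) * 𝟙 (i Fin.≟ j))
      ≡⟨ cong₂ _+_ (*-zeroʳ (h Fin.zero)) (sifting-allFin p (λ i → h (Fin.suc i)) j) ⟩
    0ℤ + h (Fin.suc j)
      ≡⟨ +-identityˡ (h (Fin.suc j)) ⟩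
    h (Fin.suc j) ∎

  length-vectors-allFin : ∀ p r → length (vectors (allFin p) r) ≡ p ^ r
  length-vectors-allFin p r =
    trans (length-vectors (allFin p) r) (cong (_^ r) (List.length-tabulate (λ i → i)))

  columns-of-low-rank : ∀ {p r} .{{_ : NonZero p}} {I : Set} (L : I → I → Fin p) → RankAtMost p L r →
    Σ (I → Vec (Fin p) r → Fin p) λ G → Σ (I → Vec (Fin p) r) λ col → ∀ x y → L x y ≡ G x (col y)
  columns-of-low-rank {p} {r} L (U , V , L≡UV) = G , col , λ x y → trans (L≡UV x y)
    (cong (λ s → sum s mod p) (List.map-cong (λ k → cong (λ v → toℕ (U x k) ℕ.* toℕ v)
                                                         (sym (lookup∘tabulate (λ k → V k y) k)))
                                             (allFin r)))
    where
    G = λ x v → sum (map (λ k → toℕ (U x k) ℕ.* toℕ (lookup v k)) (allFin r)) mod p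
    col = λ y → tabulate (λ k → V k y)

  hamming≡weight∘⊕ : (x y : Vec Bool n) → hamming x y ≡ weight (x ⊕ y)
  hamming≡weight∘⊕ []      []      = refl
  hamming≡weight∘⊕ (a ∷ x) (b ∷ y) = cong ((if a xor b then 1 else 0) ℕ.+_) (hamming≡weight∘⊕ x y)

  m<ᵇ1+n≡m≤ᵇn : ∀ m n → (m <ᵇ suc n) ≡ (m ≤ᵇ n)
  m<ᵇ1+n≡m≤ᵇn zero    n = refl
  m<ᵇ1+n≡m≤ᵇn (suc m) n = refl

  w+w≤ᵇn≡w≤ᵇ⌊n/2⌋ : ∀ n w → (w ℕ.+ w ≤ᵇ n) ≡ (w ≤ᵇ ⌊ n /2⌋)
  w+w≤ᵇn≡w≤ᵇ⌊n/2⌋ n             zero    = refl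
  w+w≤ᵇn≡w≤ᵇ⌊n/2⌋ zero          (suc w) = refl
  w+w≤ᵇn≡w≤ᵇ⌊n/2⌋ (suc zero)    (suc w) rewrite ℕ.+-suc w w = refl
  w+w≤ᵇn≡w≤ᵇ⌊n/2⌋ (suc (suc n)) (suc w) rewrite ℕ.+-suc w w =
    trans (m<ᵇ1+n≡m≤ᵇn (w ℕ.+ w) n) (trans (w+w≤ᵇn≡w≤ᵇ⌊n/2⌋ n w) (sym (m<ᵇ1+n≡m≤ᵇn w ⌊ n /2⌋)))

  ±1∘M≡threshold∘⊕ : (x y : Vec Bool n) → ±1 (M n x y) ≡ threshold (suc ⌊ n /2⌋) (x ⊕ y)
  ±1∘M≡threshold∘⊕ {n} x y = cong ±1 (begin
    2 ℕ.* hamming x y ≤ᵇ n  ≡⟨ cong (λ h → 2 ℕ.* h ≤ᵇ n) (hamming≡weight∘⊕ x y) ⟩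
    2 ℕ.* w ≤ᵇ n            ≡⟨ cong (λ v → w ℕ.+ v ≤ᵇ n) (ℕ.+-identityʳ w) ⟩
    w ℕ.+ w ≤ᵇ n            ≡⟨ w+w≤ᵇn≡w≤ᵇ⌊n/2⌋ n w ⟩
    w ≤ᵇ ⌊ n /2⌋            ≡⟨ m<ᵇ1+n≡m≤ᵇn w ⌊ n /2⌋ ⟨
    w <ᵇ suc ⌊ n /2⌋        ∎)
    where w = weight (x ⊕ y)

  correlation+2*mismatches : ∀ {p} (A : Vec Bool n → Vec Bool n → Bool)
                             (L : Vec Bool n → Vec Bool n → Fin p) →
    correlation (λ x y → ±1 (A x y)) (λ x y → ±1 (boolF (L x y))) + + (2 ℕ.* mismatches n A L)
      ≡ + (4 ^ n)
  correlation+2*mismatches {n} A L = begin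
    correlation (λ x y → ±1 (A x y)) (λ x y → ±1 (boolF (L x y))) + + (2 ℕ.* mismatches n A L)
      ≡⟨ cong (_+_ c) (trans (pos-* 2 (mismatches n A L)) (cong (+ 2 *_) +mismatches≡∑∑)) ⟩
    ∑[ x ∈ cube n ] ∑[ y ∈ cube n ] (±1 (A x y) * ±1 (boolF (L x y)))
      + + 2 * ∑[ x ∈ cube n ] ∑[ y ∈ cube n ] (+ e x y)
      ≡⟨ cong (_+_ c) (*-distribˡ-∑∑ (+ 2) (cube n) (cube n) _) ⟩
    ∑[ x ∈ cube n ] ∑[ y ∈ cube n ] (±1 (A x y) * ±1 (boolF (L x y)))
      + ∑[ x ∈ cube n ] ∑[ y ∈ cube n ] (+ 2 * + e x y)
      ≡⟨ ∑∑-distrib-+ (cube n) (cube n) _ _ ⟨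
    ∑[ x ∈ cube n ] ∑[ y ∈ cube n ] (±1 (A x y) * ±1 (boolF (L x y)) + + 2 * + e x y)
      ≡⟨ ∑-cong (cube n) (λ x → ∑-cong (cube n) (λ y → ±1*±1+2*xor≡1 (A x y) (boolF (L x y)))) ⟩
    ∑[ x ∈ cube n ] ∑[ y ∈ cube n ] 1ℤ
      ≡⟨ ∑-cong (cube n) (λ x → trans (∑-cube-1 n) (sym (*-identityˡ (+ (2 ^ n))))) ⟩
    ∑[ x ∈ cube n ] (1ℤ * + (2 ^ n))
      ≡⟨ *-distribʳ-∑ (+ (2 ^ n)) (cube n) _ ⟨
    ∑[ x ∈ cube n ] 1ℤ * + (2 ^ n)
      ≡⟨ cong (_* + (2 ^ n)) (∑-cube-1 n) ⟩
    + (2 ^ n) * + (2 ^ n)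
      ≡⟨ pos-* (2 ^ n) (2 ^ n) ⟨
    + (2 ^ n ℕ.* 2 ^ n)
      ≡⟨ cong +_ (^-distribʳ-* 2 2 n) ⟨
    + (4 ^ n) ∎
    where
    c = correlation (λ x y → ±1 (A x y)) (λ x y → ±1 (boolF (L x y)))
    e : Vec Bool n → Vec Bool n → ℕ
    e x y = if A x y xor boolF (L x y) then 1 else 0
    +mismatches≡∑∑ : + mismatches n A L ≡ ∑[ x ∈ cube n ] ∑[ y ∈ cube n ] (+ e x y)
    +mismatches≡∑∑ = trans (sym (∑-pos (cube n) (λ x → sum (map (e x) (cube n)))))
                           (∑-cong (cube n) (λ x → sym (∑-pos (cube n) (e x))))
    ±1*±1+2*xor≡1 : ∀ a b → ±1 a * ±1 b + + 2 * + (if a xor b then 1 else 0) ≡ 1ℤ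
    ±1*±1+2*xor≡1 true  true  = refl
    ±1*±1+2*xor≡1 true  false = refl
    ±1*±1+2*xor≡1 false true  = refl
    ±1*±1+2*xor≡1 false false = refl

  a∸b≤∣c∣ : ∀ {a b c} → c + + b ≡ + a → a ℕ.∸ b ℕ.≤ ∣ c ∣
  a∸b≤∣c∣ {a} {b} {c} c+b≡a = ℕ.m≤n+o⇒m∸n≤o a b
    (subst₂ ℕ._≤_ (cong ∣_∣ c+b≡a) (ℕ.+-comm ∣ c ∣ b) (∣i+j∣≤∣i∣+∣j∣ c (+ b)))

  low-rank-correlation-bound : ∀ {p} .{{_ : NonZero p}} n r (L : Vec Bool n → Vec Bool n → Fin p) →
    RankAtMost p L r →
    let D = 4 ^ n ℕ.∸ 2 ℕ.* mismatches n (M n) L in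
    D ℕ.* D ℕ.* n ℕ.≤ p ^ r ℕ.* (4 ^ n ℕ.* 4 ^ n)
  low-rank-correlation-bound {p} n r L rank with columns-of-low-rank L rank
  ... | G , col , L≡G∘col =
    ℕ.≤-trans (ℕ.*-monoˡ-≤ n (ℕ.*-mono-≤ D≤∣c∣ D≤∣c∣)) (drop‿+≤+ (subst₂ _≤_ in-ℕ in-ℕ′ c²-bound))
    where
    c = correlation (λ x y → ±1 (M n x y)) (λ x y → ±1 (boolF (L x y)))
    D≤∣c∣ : 4 ^ n ℕ.∸ 2 ℕ.* mismatches n (M n) L ℕ.≤ ∣ c ∣
    D≤∣c∣ = a∸b≤∣c∣ {c = c} (correlation+2*mismatches (M n) L)
    c≡ : c ≡ correlation (λ x y → threshold (suc ⌊ n /2⌋) (x ⊕ y)) (λ x y → ±1 (boolF (G x (col y))))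
    c≡ = ∑-cong (cube n) (λ x → ∑-cong (cube n) (λ y →
           cong₂ _*_ (±1∘M≡threshold∘⊕ x y) (cong (λ l → ±1 (boolF l)) (L≡G∘col x y))))
    c²-bound : c * c * + n ≤ + length (vectors (allFin p) r) * (+ (4 ^ n) * (+ (2 ^ n) * + (2 ^ n)))
    c²-bound = subst (λ z → z * z * + n ≤ _) (sym c≡)
      (few-columns-correlation-bound {_≟_ = ≡-dec Fin._≟_} {ks = vectors (allFin p) r}
         (sifting-vectors {_≟_ = Fin._≟_} (sifting-allFin p) r)
         (threshold (suc ⌊ n /2⌋)) n (4 ^ n) (threshold-spectrum-bound n)
         (λ x v → boolF (G x v)) col)
    in-ℕ : c * c * + n ≡ + (∣ c ∣ ℕ.* ∣ c ∣ ℕ.* n)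
    in-ℕ = trans (cong (_* + n) (x*x≡∣x∣*∣x∣ c)) (sym (pos-* (∣ c ∣ ℕ.* ∣ c ∣) n))
    in-ℕ′ : + length (vectors (allFin p) r) * (+ (4 ^ n) * (+ (2 ^ n) * + (2 ^ n)))
          ≡ + (p ^ r ℕ.* (4 ^ n ℕ.* 4 ^ n))
    in-ℕ′ = begin
      + length (vectors (allFin p) r) * (+ (4 ^ n) * (+ (2 ^ n) * + (2 ^ n)))
        ≡⟨ cong (λ l → + l * (+ (4 ^ n) * (+ (2 ^ n) * + (2 ^ n)))) (length-vectors-allFin p r) ⟩
      + (p ^ r) * (+ (4 ^ n) * (+ (2 ^ n) * + (2 ^ n)))
        ≡⟨ cong (λ z → + (p ^ r) * (+ (4 ^ n) * z))
                (trans (sym (pos-* (2 ^ n) (2 ^ n))) (cong +_ (sym (^-distribʳ-* 2 2 n)))) ⟩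
      + (p ^ r) * (+ (4 ^ n) * + (4 ^ n))
        ≡⟨ cong (+ (p ^ r) *_) (pos-* (4 ^ n) (4 ^ n)) ⟨
      + (p ^ r) * + (4 ^ n ℕ.* 4 ^ n)
        ≡⟨ pos-* (p ^ r) (4 ^ n ℕ.* 4 ^ n) ⟨
      + (p ^ r ℕ.* (4 ^ n ℕ.* 4 ^ n)) ∎

open import Data.Nat using (ℕ; _+_; _*_; _^_; _∸_; _≤_; _<_; NonZero; >-nonZero⁻¹)
open import Data.Nat.Primality using (Prime)
open import Data.Nat.Properties using (≤-trans; m≤n*m; *-mono-≤)
open Powers using ([p^r]^d≤m; square-bound-to-power)
open LowRank using (low-rank-correlation-bound)

theorem1p3 : (p : ℕ) .{{_ : NonZero p}} → Prime p →
    (c d : ℕ) → 0 < c → 0 < d →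
    Σ ℕ λ a → Σ ℕ λ b → (0 < a × 0 < b) ×
      ((n : ℕ) → 0 < n → (r : ℕ) → 2 ^ (b * r) ≤ n ^ a →
        (L : Vec Bool n → Vec Bool n → Fin p) → RankAtMost p L r →
          ((4 ^ n ∸ 2 * mismatches n (M n) L) ^ (2 * d)) * n ^ d
            ≤ ((2 * 4 ^ n) ^ (2 * d)) * n ^ (2 * c))
theorem1p3 p _ c d 0<c 0<d =
  2 * c , p * d , (≤-trans 0<c (m≤n*m c 2) , *-mono-≤ (>-nonZero⁻¹ p) 0<d) ,
  λ n _ r 2^pdr≤n^2c L rank →
    square-bound-to-power d (4 ^ n) (low-rank-correlation-bound n r L rank) ([p^r]^d≤m p d r 2^pdr≤n^2c)
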